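{- Let $W$ be a finite Coxeter group with Hecke algebra $\mathcal{H}_W$. For every word $\mathbf{w}$ in the simple reflections and every $v\in W$, $$T_vD(T_{\mathbf{w}})=q^{\ell(v)}\sum_{u\in W}R^{(v)}_{u,\mathbf{w}}(q^{ -1})\,q^{ -\ell(vu)}\,T_{vu}.$$
   Context: $\mathcal{H}_W$ is the $\mathbb{Z}[q^{\pm1}]$-algebra with basis $\{T_w\}_{w\in W}$ and relations $T_wT_s=qT_{ws}+(q-1)T_w$ if $\ell(ws)<\ell(w)$, $T_wT_s=T_{ws}$ if $\ell(ws)>\ell(w)$ ($s\in S$). For $\mathbf{w}=(s_1,\dots,s_m)$, $T_{\mathbf{w}}=T_{s_1}\cdots T_{s_m}$. $D$ is the ring involution of $\mathcal{H}_W$ with $D(q)=q^{ -1}$, $D(T_w)=T_{w^{ -1}}^{ -1}$. $R^{(v)}_{u,\varnothing}=\delta_{u,e}$; for $s\in S$, $R^{(v)}_{u,\mathbf{w}\mathbf{s}}=R^{(v)}_{us,\mathbf{w}}$ if $\ell(vus)<\ell(vu)$, and $=qR^{(v)}_{us,\mathbf{w}}+(q-1)R^{(v)}_{u,\mathbf{w}}$ if $\ell(vus)>\ell(vu)$. -}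

module Defs where

open import Level using (0ℓ)
open import Data.Nat as ℕ using (ℕ; zero; suc; _<ᵇ_)
open import Data.Integer as ℤ using (ℤ; +_; -[1+_])
open import Data.Fin as Fin using (Fin)
open import Data.Fin.Properties using () renaming (_≟_ to _≟F_)
open import Data.List as List using (List; []; _∷_; foldr; foldl; map; concatMap; reverse; length; filter; replicate; _++_)
open import Data.List.Relation.Unary.Any using (any?)
open import Data.Bool using (Bool; true; false; if_then_else_)
open import Data.Product using (Σ; _×_; _,_; ∃)
open import Relation.Nullary using (does; ¬_)
open import Relation.Binary.PropositionalEquality using (_≡_; _≢_)
open import Algebra.Bundles using (Group)
open import Algebra.Structures using (IsGroup)

powOp : {A : Set} → (A → A → A) → A → A → ℕ → A
powOp _∙_ ε x zero    = ε
powOp _∙_ ε x (suc k) = x ∙ powOp _∙_ ε x k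

wordProd : {A I : Set} → (A → A → A) → A → (I → A) → List I → A
wordProd _∙_ ε g = foldr (λ i acc → g i ∙ acc) ε

-- Finite Coxeter systems (W , S), W = Fin n, S = { s i | i : Fin r },
-- given by the Coxeter presentation
--   W = ⟨ s i | (s i s j)^(m i j) = 1 ⟩,
-- with m i i = 1, m i j = m j i, m i j ≠ 1 for i ≠ j (m i j = 0 encodes ∞,
-- since the relation x^0 = 1 is vacuous).  "Presented by" = S generates W,
-- the relations hold, and the universal property holds.

record FiniteCoxeterSystem : Set₁ where
  field
    n r     : ℕ
    _·_     : Fin n → Fin n → Fin n
    e       : Fin n
    _⁻¹     : Fin n → Fin n
    isGroup : IsGroup _≡_ _·_ e _⁻¹
    s       : Fin r → Fin n
    m       : Fin r → Fin r → ℕ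
    m-diag  : ∀ i → m i i ≡ 1
    m-sym   : ∀ i j → m i j ≡ m j i
    m-off   : ∀ i j → i ≢ j → m i j ≢ 1
    relations : ∀ i j → powOp _·_ e (s i · s j) (m i j) ≡ e
    generated : ∀ w → ∃ λ (word : List (Fin r)) → wordProd _·_ e s word ≡ w
    universal : (G : Group 0ℓ 0ℓ) (f : Fin r → Group.Carrier G) →
                (∀ i j → Group._≈_ G (powOp (Group._∙_ G) (Group.ε G) (Group._∙_ G (f i) (f j)) (m i j)) (Group.ε G)) →
                Σ (Fin n → Group.Carrier G) λ φ →
                  (∀ x y → Group._≈_ G (φ (x · y)) (Group._∙_ G (φ x) (φ y))) ×
                  (∀ i → Group._≈_ G (φ (s i)) (f i))

-- Laurent polynomials ℤ[q,q⁻¹]:  (a , c₀ ∷ c₁ ∷ ⋯)  represents  Σᵢ cᵢ q^(a+i)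

record Laurent : Set where
  constructor mkL
  field
    low    : ℤ
    coeffs : List ℤ

nth : List ℤ → ℕ → ℤ
nth []       _       = + 0
nth (c ∷ cs) zero    = c
nth (c ∷ cs) (suc j) = nth cs j

coeff : Laurent → ℤ → ℤ
coeff (mkL a cs) k with k ℤ.- a
... | + j     = nth cs j
... | -[1+ _ ] = + 0

_≈L_ : Laurent → Laurent → Set
p ≈L p' = ∀ k → coeff p k ≡ coeff p' k

addP : List ℤ → List ℤ → List ℤ
addP []       ys       = ys
addP xs       []       = xs
addP (x ∷ xs) (y ∷ ys) = (x ℤ.+ y) ∷ addP xs ys

mulP : List ℤ → List ℤ → List ℤ
mulP []       ys = []
mulP (x ∷ xs) ys = addP (map (x ℤ.*_) ys) (+ 0 ∷ mulP xs ys)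

_+L_ : Laurent → Laurent → Laurent
mkL a xs +L mkL b ys =
  let c = a ℤ.⊓ b in
  mkL c (addP (replicate ℤ.∣ a ℤ.- c ∣ (+ 0) ++ xs) (replicate ℤ.∣ b ℤ.- c ∣ (+ 0) ++ ys))

_*L_ : Laurent → Laurent → Laurent
mkL a xs *L mkL b ys = mkL (a ℤ.+ b) (mulP xs ys)

-L_ : Laurent → Laurent
-L mkL a xs = mkL a (map ℤ.-_ xs)

_-L_ : Laurent → Laurent → Laurent
p -L p' = p +L (-L p')

qˆ : ℤ → Laurent
qˆ k = mkL k (+ 1 ∷ [])

0L 1L qL q⁻¹L : Laurent
0L   = mkL (+ 0) []
1L   = qˆ (+ 0)
qL   = qˆ (+ 1)
q⁻¹L = qˆ (ℤ.- (+ 1))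

-- bar involution  q ↦ q⁻¹  on ℤ[q,q⁻¹]
barL : Laurent → Laurent
barL (mkL a cs) = mkL ((ℤ.- (a ℤ.+ + length cs)) ℤ.+ + 1) (reverse cs)

module Hecke (C : FiniteCoxeterSystem) where
  open FiniteCoxeterSystem C public

  W : Set
  W = Fin n

  prod : List (Fin r) → W
  prod = wordProd _·_ e s

  allWords : ℕ → List (List (Fin r))
  allWords zero    = [] ∷ []
  allWords (suc k) = concatMap (λ i → map (i ∷_) (allWords k)) (List.allFin r)

  -- ℓ w = least k such that w is a product of k simple reflections
  -- (search over k = 0 , 1 , … , n; every w has length < n = |W|)
  ℓ : W → ℕ
  ℓ w = go n 0
    where
    go : ℕ → ℕ → ℕ
    go zero    k = k
    go (suc f) k = if does (any? (λ wd → prod wd ≟F w) (allWords k)) then k else go f (suc k)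

  reducedWord : W → List (Fin r)
  reducedWord w with filter (λ wd → prod wd ≟F w) (allWords (ℓ w))
  ... | []       = []
  ... | (wd ∷ _) = wd

  -- elements of ℋ_W: ℤ[q,q⁻¹]-linear combinations Σ_w h(w) T_w
  H : Set
  H = W → Laurent

  _≈H_ : H → H → Set
  h ≈H h' = ∀ w → h w ≈L h' w

  sumW : (W → H) → H
  sumW f = foldr (λ w acc x → f w x +L acc x) (λ _ → 0L) (List.allFin n)

  _⊙_ : Laurent → H → H
  (a ⊙ h) x = a *L h x

  _+H_ : H → H → H
  (h +H h') x = h x +L h' x

  T : W → H
  T w x = if does (x ≟F w) then 1L else 0L

  one : H
  one = T e

  T·Ts : W → Fin r → H
  T·Ts w i = if ℓ (w · s i) <ᵇ ℓ w
             then (qL ⊙ T (w · s i)) +H ((qL -L 1L) ⊙ T w)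
             else T (w · s i)

  _·Ts_ : H → Fin r → H
  h ·Ts i = sumW (λ w → h w ⊙ T·Ts w i)

  _*H_ : H → H → H
  h *H h' = sumW (λ y → h' y ⊙ foldl _·Ts_ h (reducedWord y))

  Tword : List (Fin r) → H
  Tword = foldl _·Ts_ one

  -- D, given the family of inverses  inv w = T_w⁻¹ :
  -- D(Σ a_w T_w) = Σ ā_w T_{w⁻¹}⁻¹
  D : (W → H) → H → H
  D inv h = sumW (λ w → barL (h w) ⊙ inv (w ⁻¹))

  -- R^{(v)}_{u,𝐰}(x): the recursion with q replaced by x (i.e. the polynomial
  -- R^{(v)}_{u,𝐰} ∈ ℤ[q] evaluated at x).  Word stored reversed.
  Rrev : W → Laurent → W → List (Fin r) → Laurent
  Rrev v x u []        = if does (u ≟F e) then 1L else 0L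
  Rrev v x u (i ∷ wr)  =
    if ℓ (v · (u · s i)) <ᵇ ℓ (v · u)
    then Rrev v x (u · s i) wr
    else (x *L Rrev v x (u · s i) wr) +L ((x -L 1L) *L Rrev v x u wr)

  R : W → Laurent → W → List (Fin r) → Laurent
  R v x u word = Rrev v x u (reverse word)

module Submission where

-- Right multiplication by T_s and its inverse g ↦ q⁻¹ g T_s + (q⁻¹ - 1) g are written down on the
-- basis, and D turns the first into the second: D(g T_s) = D(g) T_s⁻¹.  Hence T_v D(T_𝐰) is T_v
-- multiplied on the right by T_{s₁}⁻¹ ⋯ T_{s_m}⁻¹, and evaluating one more factor T_s⁻¹ at a basis
-- element y splits according to whether ys is longer or shorter than y -- exactly the recursion
-- defining R^{(v)}.  For the Hecke algebra as defined (right multiplication along chosen reduced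
-- words) to behave, h T_a must depend only on the product of a reduced word a; this follows from the
-- exchange condition, obtained from Tits' action of W on reflections × {±1}, which exists by the
-- universal property of the Coxeter presentation.

open import Defs
open import Data.Integer using (+_; -_)
open import Data.List using (List)
open import Data.Fin using (Fin)

module LaurentPolynomials where

  open import Data.Nat using (zero; suc)
  open import Data.Integer as ℤ using (ℤ; +_; -[1+_]; _+_; _*_; -_; _-_)
  import Data.Integer.Properties as ℤP
  open import Data.Integer.Tactic.RingSolver using (solve-∀)
  open import Data.List using (List; []; _∷_; map; replicate; _++_; reverse; length)
  import Data.List.Properties as LP
  open import Data.List.Relation.Unary.All as All using (All; all?)
  open import Data.Maybe using (Maybe; just; nothing)
  open import Data.Product using (_,_)
  open import Relation.Nullary using (yes; no)
  open import Relation.Binary.PropositionalEquality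
  open import Algebra.Bundles using (CommutativeRing)
  open import Algebra.Structures using (IsCommutativeRing)
  open import Algebra.Properties.CommutativeSemigroup ℤP.+-commutativeSemigroup using (x∙yz≈y∙xz)
  open import Tactic.RingSolver.Core.AlmostCommutativeRing using (AlmostCommutativeRing; fromCommutativeRing)
  open ≡-Reasoning

  infix 4 _≋_ _≃_

  record _≋_ (xs ys : List ℤ) : Set where
    constructor mk≋
    field at : ∀ j → nth xs j ≡ nth ys j
  open _≋_ public

  ≋-refl : ∀ {xs} → xs ≋ xs
  ≋-refl = mk≋ λ j → refl

  ≋-sym : ∀ {xs ys} → xs ≋ ys → ys ≋ xs
  ≋-sym e = mk≋ λ j → sym (at e j)

  ≋-trans : ∀ {xs ys zs} → xs ≋ ys → ys ≋ zs → xs ≋ zs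
  ≋-trans e f = mk≋ λ j → trans (at e j) (at f j)

  nth-addP : ∀ xs ys j → nth (addP xs ys) j ≡ nth xs j + nth ys j
  nth-addP []       ys       j       = sym (ℤP.+-identityˡ _)
  nth-addP (x ∷ xs) []       j       = sym (ℤP.+-identityʳ _)
  nth-addP (x ∷ xs) (y ∷ ys) zero    = refl
  nth-addP (x ∷ xs) (y ∷ ys) (suc j) = nth-addP xs ys j

  nth-scale : ∀ c ys j → nth (map (c *_) ys) j ≡ c * nth ys j
  nth-scale c []       j       = sym (ℤP.*-zeroʳ c)
  nth-scale c (y ∷ ys) zero    = refl
  nth-scale c (y ∷ ys) (suc j) = nth-scale c ys j

  nth-neg : ∀ ys j → nth (map -_ ys) j ≡ - nth ys j
  nth-neg []       j       = refl
  nth-neg (y ∷ ys) zero    = refl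
  nth-neg (y ∷ ys) (suc j) = nth-neg ys j

  nth-mulP : ∀ x xs ys j → nth (mulP (x ∷ xs) ys) j ≡ x * nth ys j + nth (+ 0 ∷ mulP xs ys) j
  nth-mulP x xs ys j =
    trans (nth-addP (map (x *_) ys) (+ 0 ∷ mulP xs ys) j) (cong (_+ _) (nth-scale x ys j))

  nth-0∷ : ∀ {A B C : List ℤ} (f : ℤ → ℤ → ℤ) → f (+ 0) (+ 0) ≡ + 0 →
           (∀ j → nth A j ≡ f (nth B j) (nth C j)) →
           ∀ j → nth (+ 0 ∷ A) j ≡ f (nth (+ 0 ∷ B) j) (nth (+ 0 ∷ C) j)
  nth-0∷ f f00 e zero    = sym f00
  nth-0∷ f f00 e (suc j) = e j

  ∷-cong : ∀ {x xs ys} → xs ≋ ys → (x ∷ xs) ≋ (x ∷ ys)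
  ∷-cong e = mk≋ λ where
    zero    → refl
    (suc j) → at e j

  addP-cong : ∀ {xs xs' ys ys'} → xs ≋ xs' → ys ≋ ys' → addP xs ys ≋ addP xs' ys'
  addP-cong {xs} {xs'} {ys} {ys'} e f = mk≋ λ j →
    trans (nth-addP xs ys j) (trans (cong₂ _+_ (at e j) (at f j)) (sym (nth-addP xs' ys' j)))

  scale-cong : ∀ {c xs ys} → xs ≋ ys → map (c *_) xs ≋ map (c *_) ys
  scale-cong {c} {xs} {ys} e = mk≋ λ j →
    trans (nth-scale c xs j) (trans (cong (c *_) (at e j)) (sym (nth-scale c ys j)))

  addP-identityʳ : ∀ xs → addP xs [] ≋ xs
  addP-identityʳ xs = mk≋ λ j → trans (nth-addP xs [] j) (ℤP.+-identityʳ _)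

  0∷[]≋[] : (+ 0 ∷ []) ≋ []
  0∷[]≋[] = mk≋ λ where
    zero    → refl
    (suc j) → refl

  mulP-congʳ : ∀ xs {ys ys'} → ys ≋ ys' → mulP xs ys ≋ mulP xs ys'
  mulP-congʳ []       e = ≋-refl
  mulP-congʳ (x ∷ xs) e = addP-cong (scale-cong {x} e) (∷-cong (mulP-congʳ xs e))

  mulP-zeroʳ : ∀ xs → mulP xs [] ≋ []
  mulP-zeroʳ []       = ≋-refl
  mulP-zeroʳ (x ∷ xs) = ≋-trans (∷-cong (mulP-zeroʳ xs)) 0∷[]≋[]

  mulP-0∷ʳ : ∀ xs y ys → mulP xs (y ∷ ys) ≋ addP (map (y *_) xs) (+ 0 ∷ mulP xs ys)
  mulP-0∷ʳ []       y ys = ≋-sym 0∷[]≋[]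
  mulP-0∷ʳ (x ∷ xs) y ys = mk≋ λ where
    zero    → cong (_+ + 0) (ℤP.*-comm x y)
    (suc j) → begin
      nth (addP (map (x *_) ys) (mulP xs (y ∷ ys))) j
        ≡⟨ nth-addP (map (x *_) ys) (mulP xs (y ∷ ys)) j ⟩
      nth (map (x *_) ys) j + nth (mulP xs (y ∷ ys)) j
        ≡⟨ cong₂ _+_ (nth-scale x ys j)
             (trans (at (mulP-0∷ʳ xs y ys) j) (nth-addP (map (y *_) xs) _ j)) ⟩
      x * nth ys j + (nth (map (y *_) xs) j + nth (+ 0 ∷ mulP xs ys) j)
        ≡⟨ x∙yz≈y∙xz (x * nth ys j) (nth (map (y *_) xs) j) _ ⟩
      nth (map (y *_) xs) j + (x * nth ys j + nth (+ 0 ∷ mulP xs ys) j)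
        ≡⟨ cong (_+_ (nth (map (y *_) xs) j)) (sym (nth-mulP x xs ys j)) ⟩
      nth (map (y *_) xs) j + nth (mulP (x ∷ xs) ys) j
        ≡⟨ sym (nth-addP (map (y *_) xs) (mulP (x ∷ xs) ys) j) ⟩
      nth (addP (map (y *_) xs) (mulP (x ∷ xs) ys)) j ∎

  mulP-comm : ∀ xs ys → mulP xs ys ≋ mulP ys xs
  mulP-comm xs []       = mulP-zeroʳ xs
  mulP-comm xs (y ∷ ys) =
    ≋-trans (mulP-0∷ʳ xs y ys) (addP-cong (≋-refl {map (y *_) xs}) (∷-cong (mulP-comm xs ys)))

  mulP-congˡ : ∀ {xs xs'} ys → xs ≋ xs' → mulP xs ys ≋ mulP xs' ys
  mulP-congˡ {xs} {xs'} ys e =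
    ≋-trans (mulP-comm xs ys) (≋-trans (mulP-congʳ ys e) (mulP-comm ys xs'))

  mulP-distribʳ : ∀ xs ys zs → mulP (addP xs ys) zs ≋ addP (mulP xs zs) (mulP ys zs)
  mulP-distribʳ []       ys       zs = mk≋ λ j → sym (trans (nth-addP [] (mulP ys zs) j) (ℤP.+-identityˡ _))
  mulP-distribʳ (x ∷ xs) []       zs = ≋-sym (addP-identityʳ (mulP (x ∷ xs) zs))
  mulP-distribʳ (x ∷ xs) (y ∷ ys) zs = mk≋ λ j → begin
      nth (mulP (x + y ∷ addP xs ys) zs) j
        ≡⟨ nth-mulP (x + y) (addP xs ys) zs j ⟩
      (x + y) * nth zs j + nth (+ 0 ∷ mulP (addP xs ys) zs) j
        ≡⟨ cong (_+_ ((x + y) * nth zs j)) (nth-0∷ _+_ refl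
             (λ i → trans (at (mulP-distribʳ xs ys zs) i) (nth-addP (mulP xs zs) (mulP ys zs) i)) j) ⟩
      (x + y) * nth zs j + (nth (+ 0 ∷ mulP xs zs) j + nth (+ 0 ∷ mulP ys zs) j)
        ≡⟨ regroup x y (nth zs j) _ _ ⟩
      (x * nth zs j + nth (+ 0 ∷ mulP xs zs) j) + (y * nth zs j + nth (+ 0 ∷ mulP ys zs) j)
        ≡⟨ sym (cong₂ _+_ (nth-mulP x xs zs j) (nth-mulP y ys zs j)) ⟩
      nth (mulP (x ∷ xs) zs) j + nth (mulP (y ∷ ys) zs) j
        ≡⟨ sym (nth-addP (mulP (x ∷ xs) zs) (mulP (y ∷ ys) zs) j) ⟩
      nth (addP (mulP (x ∷ xs) zs) (mulP (y ∷ ys) zs)) j ∎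
    where
    regroup : ∀ a b c d e → (a + b) * c + (d + e) ≡ (a * c + d) + (b * c + e)
    regroup = solve-∀

  mulP-distribˡ : ∀ xs ys zs → mulP xs (addP ys zs) ≋ addP (mulP xs ys) (mulP xs zs)
  mulP-distribˡ xs ys zs =
    ≋-trans (mulP-comm xs (addP ys zs))
    (≋-trans (mulP-distribʳ ys zs xs) (addP-cong (mulP-comm ys xs) (mulP-comm zs xs)))

  mulP-scaleˡ : ∀ c xs ys → mulP (map (c *_) xs) ys ≋ map (c *_) (mulP xs ys)
  mulP-scaleˡ c []       ys = ≋-refl
  mulP-scaleˡ c (x ∷ xs) ys = mk≋ λ j → begin
      nth (mulP (c * x ∷ map (c *_) xs) ys) j
        ≡⟨ nth-mulP (c * x) (map (c *_) xs) ys j ⟩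
      c * x * nth ys j + nth (+ 0 ∷ mulP (map (c *_) xs) ys) j
        ≡⟨ cong (_+_ (c * x * nth ys j)) (nth-0∷ {C = []} (λ a _ → c * a) (ℤP.*-zeroʳ c)
             (λ i → trans (at (mulP-scaleˡ c xs ys) i) (nth-scale c (mulP xs ys) i)) j) ⟩
      c * x * nth ys j + c * nth (+ 0 ∷ mulP xs ys) j
        ≡⟨ factor c x (nth ys j) _ ⟩
      c * (x * nth ys j + nth (+ 0 ∷ mulP xs ys) j)
        ≡⟨ cong (c *_) (sym (nth-mulP x xs ys j)) ⟩
      c * nth (mulP (x ∷ xs) ys) j
        ≡⟨ sym (nth-scale c (mulP (x ∷ xs) ys) j) ⟩
      nth (map (c *_) (mulP (x ∷ xs) ys)) j ∎
    where
    factor : ∀ c x y t → c * x * y + c * t ≡ c * (x * y + t)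
    factor = solve-∀

  mulP-0∷ˡ : ∀ xs ys → mulP (+ 0 ∷ xs) ys ≋ (+ 0 ∷ mulP xs ys)
  mulP-0∷ˡ xs ys = mk≋ λ j →
    trans (nth-mulP (+ 0) xs ys j)
      (trans (cong (_+ nth (+ 0 ∷ mulP xs ys) j) (ℤP.*-zeroˡ (nth ys j))) (ℤP.+-identityˡ _))

  mulP-assoc : ∀ xs ys zs → mulP (mulP xs ys) zs ≋ mulP xs (mulP ys zs)
  mulP-assoc []       ys zs = ≋-refl
  mulP-assoc (x ∷ xs) ys zs =
    ≋-trans (mulP-distribʳ (map (x *_) ys) (+ 0 ∷ mulP xs ys) zs)
      (addP-cong (mulP-scaleˡ x ys zs)
        (≋-trans (mulP-0∷ˡ (mulP xs ys) zs) (∷-cong (mulP-assoc xs ys zs))))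

  mulP-identityˡ : ∀ ys → mulP (+ 1 ∷ []) ys ≋ ys
  mulP-identityˡ ys = mk≋ λ j →
    trans (nth-mulP (+ 1) [] ys j)
      (trans (cong₂ _+_ (ℤP.*-identityˡ (nth ys j)) (at 0∷[]≋[] j)) (ℤP.+-identityʳ _))

  mulP-single : ∀ x ys → mulP (x ∷ []) ys ≋ map (x *_) ys
  mulP-single x ys = ≋-trans (addP-cong (≋-refl {map (x *_) ys}) 0∷[]≋[]) (addP-identityʳ (map (x *_) ys))

  mulP-padˡ : ∀ d xs ys → mulP (replicate d (+ 0) ++ xs) ys ≋ (replicate d (+ 0) ++ mulP xs ys)
  mulP-padˡ zero    xs ys = ≋-refl
  mulP-padˡ (suc d) xs ys = ≋-trans (mulP-0∷ˡ (replicate d (+ 0) ++ xs) ys) (∷-cong (mulP-padˡ d xs ys))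

  nthℤ : List ℤ → ℤ → ℤ
  nthℤ cs (+ j)    = nth cs j
  nthℤ cs -[1+ j ] = + 0

  coeff-nthℤ : ∀ a cs k → coeff (mkL a cs) k ≡ nthℤ cs (k - a)
  coeff-nthℤ a cs k with k - a
  ... | + j      = refl
  ... | -[1+ j ] = refl

  nthℤ-cong : ∀ {xs ys} → xs ≋ ys → ∀ i → nthℤ xs i ≡ nthℤ ys i
  nthℤ-cong e (+ j)    = at e j
  nthℤ-cong e -[1+ j ] = refl

  nthℤ-addP : ∀ xs ys i → nthℤ (addP xs ys) i ≡ nthℤ xs i + nthℤ ys i
  nthℤ-addP xs ys (+ j)    = nth-addP xs ys j
  nthℤ-addP xs ys -[1+ j ] = refl

  nthℤ-neg : ∀ xs i → nthℤ (map -_ xs) i ≡ - nthℤ xs i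
  nthℤ-neg xs (+ j)    = nth-neg xs j
  nthℤ-neg xs -[1+ j ] = refl

  nthℤ-scale : ∀ x ys i → nthℤ (map (x *_) ys) i ≡ x * nthℤ ys i
  nthℤ-scale x ys (+ j)    = nth-scale x ys j
  nthℤ-scale x ys -[1+ j ] = sym (ℤP.*-zeroʳ x)

  nthℤ-[] : ∀ i → nthℤ [] i ≡ + 0
  nthℤ-[] (+ j)    = refl
  nthℤ-[] -[1+ j ] = refl

  nthℤ-0∷ : ∀ xs i → nthℤ (+ 0 ∷ xs) i ≡ nthℤ xs (i - + 1)
  nthℤ-0∷ xs (+ zero)  = refl
  nthℤ-0∷ xs (+ suc j) = refl
  nthℤ-0∷ xs -[1+ j ]  = refl

  nthℤ-pad : ∀ d xs i → nthℤ (replicate d (+ 0) ++ xs) i ≡ nthℤ xs (i - + d)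
  nthℤ-pad zero    xs i = cong (nthℤ xs) (sym (ℤP.+-identityʳ i))
  nthℤ-pad (suc d) xs i =
    trans (nthℤ-0∷ (replicate d (+ 0) ++ xs) i)
      (trans (nthℤ-pad d xs (i - + 1)) (cong (nthℤ xs) (shift i (+ d))))
    where
    shift : ∀ i d → (i - + 1) - d ≡ i - (+ 1 + d)
    shift = solve-∀

  nthℤ-++ : ∀ xs ys i → nthℤ (xs ++ ys) i ≡ nthℤ xs i + nthℤ ys (i - + length xs)
  nthℤ-++ []       ys i         =
    sym (trans (cong₂ _+_ (nthℤ-[] i) (cong (nthℤ ys) (ℤP.+-identityʳ i))) (ℤP.+-identityˡ _))
  nthℤ-++ (x ∷ xs) ys (+ zero)  = sym (ℤP.+-identityʳ x)
  nthℤ-++ (x ∷ xs) ys (+ suc j) =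
    trans (nthℤ-++ xs ys (+ j)) (cong (λ t → nth xs j + nthℤ ys t) (sym (suc-sub j (length xs))))
    where
    suc-sub : ∀ j n → + suc j - + suc n ≡ + j - + n
    suc-sub j n = trans (ℤP.m-n≡m⊖n (suc j) (suc n))
                    (trans (ℤP.[1+m]⊖[1+n]≡m⊖n j n) (sym (ℤP.m-n≡m⊖n j n)))
  nthℤ-++ (x ∷ xs) ys -[1+ j ]  = sym (ℤP.+-identityˡ _)

  nthℤ-single : ∀ c t → nthℤ (c ∷ []) t ≡ nthℤ (c ∷ []) (- t)
  nthℤ-single c (+ zero)  = refl
  nthℤ-single c (+ suc n) = refl
  nthℤ-single c -[1+ n ]  = refl

  nthℤ-reverse : ∀ cs i → nthℤ (reverse cs) i ≡ nthℤ cs ((+ length cs - + 1) - i)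
  nthℤ-reverse []       i = trans (nthℤ-[] i) (sym (nthℤ-[] ((+ 0 - + 1) - i)))
  nthℤ-reverse (c ∷ cs) i = begin
    nthℤ (reverse (c ∷ cs)) i
      ≡⟨ cong (λ xs → nthℤ xs i) (LP.unfold-reverse c cs) ⟩
    nthℤ (reverse cs ++ (c ∷ [])) i
      ≡⟨ nthℤ-++ (reverse cs) (c ∷ []) i ⟩
    nthℤ (reverse cs) i + nthℤ (c ∷ []) (i - + length (reverse cs))
      ≡⟨ cong₂ (λ a b → a + nthℤ (c ∷ []) (i - + b)) (nthℤ-reverse cs i) (LP.length-reverse cs) ⟩
    nthℤ cs ((l - + 1) - i) + nthℤ (c ∷ []) (i - l)
      ≡⟨ cong₂ _+_ (cong (nthℤ cs) (e₁ l i))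
           (trans (cong (nthℤ (c ∷ [])) (e₂ l i)) (sym (nthℤ-single c (l - i)))) ⟩
    nthℤ cs ((l - i) - + 1) + nthℤ (c ∷ []) (l - i)
      ≡⟨ ℤP.+-comm (nthℤ cs ((l - i) - + 1)) _ ⟩
    nthℤ (c ∷ []) (l - i) + nthℤ cs ((l - i) - + 1)
      ≡⟨ sym (nthℤ-++ (c ∷ []) cs (l - i)) ⟩
    nthℤ (c ∷ cs) (l - i)
      ≡⟨ cong (nthℤ (c ∷ cs)) (e₃ l i) ⟩
    nthℤ (c ∷ cs) ((+ suc (length cs) - + 1) - i) ∎
    where
    l = + length cs
    e₁ : ∀ l i → (l - + 1) - i ≡ (l - i) - + 1
    e₁ = solve-∀
    e₂ : ∀ l i → i - l ≡ - (l - i)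
    e₂ = solve-∀
    e₃ : ∀ l i → l - i ≡ ((+ 1 + l) - + 1) - i
    e₃ = solve-∀

  record _≃_ (p p' : Laurent) : Set where
    constructor mk≃
    field get : p ≈L p'
  open _≃_ public

  ≃-refl : ∀ {p} → p ≃ p
  ≃-refl = mk≃ λ k → refl

  ≃-reflexive : ∀ {p p'} → p ≡ p' → p ≃ p'
  ≃-reflexive refl = ≃-refl

  ≃-sym : ∀ {p p'} → p ≃ p' → p' ≃ p
  ≃-sym e = mk≃ λ k → sym (get e k)

  ≃-trans : ∀ {p p' p''} → p ≃ p' → p' ≃ p'' → p ≃ p''
  ≃-trans e f = mk≃ λ k → trans (get e k) (get f k)

  mkL-cong : ∀ {c xs ys} → xs ≋ ys → mkL c xs ≃ mkL c ys
  mkL-cong {c} {xs} {ys} e = mk≃ λ k →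
    trans (coeff-nthℤ c xs k) (trans (nthℤ-cong e (k - c)) (sym (coeff-nthℤ c ys k)))

  mkL-injective : ∀ {c xs ys} → mkL c xs ≃ mkL c ys → xs ≋ ys
  mkL-injective {c} {xs} {ys} e = mk≋ λ j → begin
    nth xs j                   ≡⟨ cong (nthℤ xs) (sym (cancel c (+ j))) ⟩
    nthℤ xs ((c + + j) - c)    ≡⟨ sym (coeff-nthℤ c xs (c + + j)) ⟩
    coeff (mkL c xs) (c + + j) ≡⟨ get e (c + + j) ⟩
    coeff (mkL c ys) (c + + j) ≡⟨ coeff-nthℤ c ys (c + + j) ⟩
    nthℤ ys ((c + + j) - c)    ≡⟨ cong (nthℤ ys) (cancel c (+ j)) ⟩
    nth ys j                   ∎
    where
    cancel : ∀ c t → (c + t) - c ≡ t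
    cancel = solve-∀

  mkL-pad : ∀ a c d xs → c + + d ≡ a → mkL a xs ≃ mkL c (replicate d (+ 0) ++ xs)
  mkL-pad a c d xs c+d≡a = mk≃ λ k → begin
    coeff (mkL a xs) k                        ≡⟨ coeff-nthℤ a xs k ⟩
    nthℤ xs (k - a)                           ≡⟨ cong (λ t → nthℤ xs (k - t)) (sym c+d≡a) ⟩
    nthℤ xs (k - (c + + d))                   ≡⟨ cong (nthℤ xs) (shift k c (+ d)) ⟩
    nthℤ xs ((k - c) - + d)                   ≡⟨ sym (nthℤ-pad d xs (k - c)) ⟩
    nthℤ (replicate d (+ 0) ++ xs) (k - c)    ≡⟨ sym (coeff-nthℤ c _ k) ⟩
    coeff (mkL c (replicate d (+ 0) ++ xs)) k ∎
    where
    shift : ∀ k c d → k - (c + d) ≡ (k - c) - d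
    shift = solve-∀

  ⊓-pad : ∀ a b → (a ℤ.⊓ b) + + ℤ.∣ a - (a ℤ.⊓ b) ∣ ≡ a
  ⊓-pad a b =
    trans (cong (_+_ (a ℤ.⊓ b)) (ℤP.0≤i⇒+∣i∣≡i (ℤP.i≤j⇒0≤j-i (ℤP.i⊓j≤i a b)))) (cancel (a ℤ.⊓ b) a)
    where
    cancel : ∀ m a → m + (a - m) ≡ a
    cancel = solve-∀

  ⊓-pad' : ∀ a b → (a ℤ.⊓ b) + + ℤ.∣ b - (a ℤ.⊓ b) ∣ ≡ b
  ⊓-pad' a b = subst (λ m → m + + ℤ.∣ b - m ∣ ≡ b) (ℤP.⊓-comm b a) (⊓-pad b a)

  coeff-+L : ∀ p p' k → coeff (p +L p') k ≡ coeff p k + coeff p' k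
  coeff-+L (mkL a xs) (mkL b ys) k = begin
    coeff (mkL m (addP xs' ys')) k          ≡⟨ coeff-nthℤ m _ k ⟩
    nthℤ (addP xs' ys') (k - m)             ≡⟨ nthℤ-addP xs' ys' (k - m) ⟩
    nthℤ xs' (k - m) + nthℤ ys' (k - m)     ≡⟨ sym (cong₂ _+_ (padded a xs (⊓-pad a b)) (padded b ys (⊓-pad' a b))) ⟩
    coeff (mkL a xs) k + coeff (mkL b ys) k ∎
    where
    m = a ℤ.⊓ b
    xs' = replicate ℤ.∣ a - m ∣ (+ 0) ++ xs
    ys' = replicate ℤ.∣ b - m ∣ (+ 0) ++ ys
    padded : ∀ c zs → m + + ℤ.∣ c - m ∣ ≡ c →
             coeff (mkL c zs) k ≡ nthℤ (replicate ℤ.∣ c - m ∣ (+ 0) ++ zs) (k - m)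
    padded c zs eq = trans (get (mkL-pad c m _ zs eq) k) (coeff-nthℤ m _ k)

  coeff--L : ∀ p k → coeff (-L p) k ≡ - coeff p k
  coeff--L (mkL a xs) k = trans (coeff-nthℤ a _ k) (trans (nthℤ-neg xs (k - a)) (cong -_ (sym (coeff-nthℤ a xs k))))

  coeff-zero : ∀ a k → coeff (mkL a []) k ≡ + 0
  coeff-zero a k = trans (coeff-nthℤ a [] k) (nthℤ-[] (k - a))

  mkL-[]-cong : ∀ {a b} → mkL a [] ≃ mkL b []
  mkL-[]-cong {a} {b} = mk≃ λ k → trans (coeff-zero a k) (sym (coeff-zero b k))

  coeff-monomial*L : ∀ a x r k → coeff (mkL a (x ∷ []) *L r) k ≡ x * coeff r (k - a)
  coeff-monomial*L a x (mkL b ys) k = begin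
    coeff (mkL (a + b) (mulP (x ∷ []) ys)) k ≡⟨ coeff-nthℤ _ _ k ⟩
    nthℤ (mulP (x ∷ []) ys) (k - (a + b))    ≡⟨ nthℤ-cong (mulP-single x ys) (k - (a + b)) ⟩
    nthℤ (map (x *_) ys) (k - (a + b))       ≡⟨ nthℤ-scale x ys (k - (a + b)) ⟩
    x * nthℤ ys (k - (a + b))                ≡⟨ cong (λ t → x * nthℤ ys t) (shift k a b) ⟩
    x * nthℤ ys ((k - a) - b)                ≡⟨ cong (x *_) (sym (coeff-nthℤ b ys (k - a))) ⟩
    x * coeff (mkL b ys) (k - a)             ∎
    where
    shift : ∀ k a b → k - (a + b) ≡ (k - a) - b
    shift = solve-∀

  *L-padˡ : ∀ a c d xs r → c + + d ≡ a → (mkL a xs *L r) ≃ (mkL c (replicate d (+ 0) ++ xs) *L r)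
  *L-padˡ a c d xs (mkL b ys) c+d≡a = mk≃ λ k → begin
    coeff (mkL (a + b) (mulP xs ys)) k                        ≡⟨ coeff-nthℤ _ _ k ⟩
    nthℤ (mulP xs ys) (k - (a + b))                           ≡⟨ cong (λ t → nthℤ (mulP xs ys) (k - (t + b))) (sym c+d≡a) ⟩
    nthℤ (mulP xs ys) (k - ((c + + d) + b))                   ≡⟨ cong (nthℤ (mulP xs ys)) (shift k c (+ d) b) ⟩
    nthℤ (mulP xs ys) ((k - (c + b)) - + d)                   ≡⟨ sym (nthℤ-pad d (mulP xs ys) (k - (c + b))) ⟩
    nthℤ (replicate d (+ 0) ++ mulP xs ys) (k - (c + b))      ≡⟨ sym (nthℤ-cong (mulP-padˡ d xs ys) (k - (c + b))) ⟩
    nthℤ (mulP (replicate d (+ 0) ++ xs) ys) (k - (c + b))    ≡⟨ sym (coeff-nthℤ _ _ k) ⟩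
    coeff (mkL (c + b) (mulP (replicate d (+ 0) ++ xs) ys)) k ∎
    where
    shift : ∀ k c d b → k - ((c + d) + b) ≡ (k - (c + b)) - d
    shift = solve-∀

  *L-congˡ : ∀ {p p'} r → p ≃ p' → (p *L r) ≃ (p' *L r)
  *L-congˡ {mkL a xs} {mkL a' xs'} (mkL b ys) e =
    ≃-trans (*L-padˡ a m _ xs (mkL b ys) (⊓-pad a a'))
      (≃-trans (mkL-cong (mulP-congˡ ys (mkL-injective padded)))
        (≃-sym (*L-padˡ a' m _ xs' (mkL b ys) (⊓-pad' a a'))))
    where
    m = a ℤ.⊓ a'
    padded : mkL m (replicate ℤ.∣ a - m ∣ (+ 0) ++ xs) ≃ mkL m (replicate ℤ.∣ a' - m ∣ (+ 0) ++ xs')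
    padded = ≃-trans (≃-sym (mkL-pad a m _ xs (⊓-pad a a'))) (≃-trans e (mkL-pad a' m _ xs' (⊓-pad' a a')))

  *L-comm : ∀ p r → (p *L r) ≃ (r *L p)
  *L-comm (mkL a xs) (mkL b ys) = mk≃ λ k → begin
    coeff (mkL (a + b) (mulP xs ys)) k ≡⟨ coeff-nthℤ _ _ k ⟩
    nthℤ (mulP xs ys) (k - (a + b))    ≡⟨ nthℤ-cong (mulP-comm xs ys) (k - (a + b)) ⟩
    nthℤ (mulP ys xs) (k - (a + b))    ≡⟨ cong (λ t → nthℤ (mulP ys xs) (k - t)) (ℤP.+-comm a b) ⟩
    nthℤ (mulP ys xs) (k - (b + a))    ≡⟨ sym (coeff-nthℤ _ _ k) ⟩
    coeff (mkL (b + a) (mulP ys xs)) k ∎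

  *L-congʳ : ∀ p {r r'} → r ≃ r' → (p *L r) ≃ (p *L r')
  *L-congʳ p {r} {r'} e = ≃-trans (*L-comm p r) (≃-trans (*L-congˡ p e) (*L-comm r' p))

  *L-cong : ∀ {p p' r r'} → p ≃ p' → r ≃ r' → (p *L r) ≃ (p' *L r')
  *L-cong {p} {p'} {r} {r'} e f = ≃-trans (*L-congˡ r e) (*L-congʳ p' f)

  *L-assoc : ∀ p r s → ((p *L r) *L s) ≃ (p *L (r *L s))
  *L-assoc (mkL a xs) (mkL b ys) (mkL c zs) = mk≃ λ k → begin
    coeff (mkL ((a + b) + c) (mulP (mulP xs ys) zs)) k ≡⟨ coeff-nthℤ _ _ k ⟩
    nthℤ (mulP (mulP xs ys) zs) (k - ((a + b) + c))    ≡⟨ nthℤ-cong (mulP-assoc xs ys zs) (k - ((a + b) + c)) ⟩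
    nthℤ (mulP xs (mulP ys zs)) (k - ((a + b) + c))    ≡⟨ cong (λ t → nthℤ (mulP xs (mulP ys zs)) (k - t)) (ℤP.+-assoc a b c) ⟩
    nthℤ (mulP xs (mulP ys zs)) (k - (a + (b + c)))    ≡⟨ sym (coeff-nthℤ _ _ k) ⟩
    coeff (mkL (a + (b + c)) (mulP xs (mulP ys zs))) k ∎

  +L-cong : ∀ {p p' r r'} → p ≃ p' → r ≃ r' → (p +L r) ≃ (p' +L r')
  +L-cong {p} {p'} {r} {r'} e f = mk≃ λ k →
    trans (coeff-+L p r k) (trans (cong₂ _+_ (get e k) (get f k)) (sym (coeff-+L p' r' k)))

  *L-distribˡ : ∀ p r s → (p *L (r +L s)) ≃ ((p *L r) +L (p *L s))
  *L-distribˡ (mkL a xs) (mkL b ys) (mkL c zs) = mk≃ λ k → begin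
    coeff (mkL (a + m) (mulP xs (addP ys' zs'))) k
      ≡⟨ coeff-nthℤ _ _ k ⟩
    nthℤ (mulP xs (addP ys' zs')) (k - (a + m))
      ≡⟨ nthℤ-cong (mulP-distribˡ xs ys' zs') (k - (a + m)) ⟩
    nthℤ (addP (mulP xs ys') (mulP xs zs')) (k - (a + m))
      ≡⟨ nthℤ-addP (mulP xs ys') (mulP xs zs') (k - (a + m)) ⟩
    nthℤ (mulP xs ys') (k - (a + m)) + nthℤ (mulP xs zs') (k - (a + m))
      ≡⟨ sym (cong₂ _+_ (coeff-nthℤ _ _ k) (coeff-nthℤ _ _ k)) ⟩
    coeff (mkL (a + m) (mulP xs ys')) k + coeff (mkL (a + m) (mulP xs zs')) k
      ≡⟨ sym (cong₂ _+_ (get (*L-congʳ (mkL a xs) (mkL-pad b m _ ys (⊓-pad b c))) k)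
                         (get (*L-congʳ (mkL a xs) (mkL-pad c m _ zs (⊓-pad' b c))) k)) ⟩
    coeff (mkL a xs *L mkL b ys) k + coeff (mkL a xs *L mkL c zs) k
      ≡⟨ sym (coeff-+L (mkL a xs *L mkL b ys) _ k) ⟩
    coeff ((mkL a xs *L mkL b ys) +L (mkL a xs *L mkL c zs)) k ∎
    where
    m = b ℤ.⊓ c
    ys' = replicate ℤ.∣ b - m ∣ (+ 0) ++ ys
    zs' = replicate ℤ.∣ c - m ∣ (+ 0) ++ zs

  *L-identityˡ : ∀ p → (1L *L p) ≃ p
  *L-identityˡ (mkL a xs) = mk≃ λ k → begin
    coeff (mkL (+ 0 + a) (mulP (+ 1 ∷ []) xs)) k ≡⟨ coeff-nthℤ _ _ k ⟩
    nthℤ (mulP (+ 1 ∷ []) xs) (k - (+ 0 + a))    ≡⟨ nthℤ-cong (mulP-identityˡ xs) (k - (+ 0 + a)) ⟩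
    nthℤ xs (k - (+ 0 + a))                      ≡⟨ cong (λ t → nthℤ xs (k - t)) (ℤP.+-identityˡ a) ⟩
    nthℤ xs (k - a)                              ≡⟨ sym (coeff-nthℤ _ _ k) ⟩
    coeff (mkL a xs) k                           ∎

  *L-zeroˡ : ∀ p → (0L *L p) ≃ 0L
  *L-zeroˡ (mkL a xs) = mkL-[]-cong

  coeffwise : ∀ {p r} → (∀ k → coeff p k ≡ coeff r k) → p ≃ r
  coeffwise = mk≃

  +L-assoc : ∀ p r s → ((p +L r) +L s) ≃ (p +L (r +L s))
  +L-assoc p r s = coeffwise λ k → begin
    coeff ((p +L r) +L s) k             ≡⟨ coeff-+L (p +L r) s k ⟩
    coeff (p +L r) k + coeff s k        ≡⟨ cong (_+ coeff s k) (coeff-+L p r k) ⟩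
    (coeff p k + coeff r k) + coeff s k ≡⟨ ℤP.+-assoc (coeff p k) _ _ ⟩
    coeff p k + (coeff r k + coeff s k) ≡⟨ cong (_+_ (coeff p k)) (sym (coeff-+L r s k)) ⟩
    coeff p k + coeff (r +L s) k        ≡⟨ sym (coeff-+L p (r +L s) k) ⟩
    coeff (p +L (r +L s)) k             ∎

  +L-comm : ∀ p r → (p +L r) ≃ (r +L p)
  +L-comm p r = coeffwise λ k →
    trans (coeff-+L p r k) (trans (ℤP.+-comm (coeff p k) _) (sym (coeff-+L r p k)))

  +L-identityˡ : ∀ p → (0L +L p) ≃ p
  +L-identityˡ p = coeffwise λ k →
    trans (coeff-+L 0L p k) (trans (cong (_+ coeff p k) (coeff-zero (+ 0) k)) (ℤP.+-identityˡ _))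

  +L-identityʳ : ∀ p → (p +L 0L) ≃ p
  +L-identityʳ p = ≃-trans (+L-comm p 0L) (+L-identityˡ p)

  -L-inverseˡ : ∀ p → ((-L p) +L p) ≃ 0L
  -L-inverseˡ p = coeffwise λ k →
    trans (coeff-+L (-L p) p k)
      (trans (cong (_+ coeff p k) (coeff--L p k)) (trans (ℤP.+-inverseˡ (coeff p k)) (sym (coeff-zero (+ 0) k))))

  -L-inverseʳ : ∀ p → (p +L (-L p)) ≃ 0L
  -L-inverseʳ p = ≃-trans (+L-comm p (-L p)) (-L-inverseˡ p)

  -L-cong : ∀ {p r} → p ≃ r → (-L p) ≃ (-L r)
  -L-cong {p} {r} e = coeffwise λ k → trans (coeff--L p k) (trans (cong -_ (get e k)) (sym (coeff--L r k)))

  *L-identityʳ : ∀ p → (p *L 1L) ≃ p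
  *L-identityʳ p = ≃-trans (*L-comm p 1L) (*L-identityˡ p)

  *L-distribʳ : ∀ p r s → ((r +L s) *L p) ≃ ((r *L p) +L (s *L p))
  *L-distribʳ p r s =
    ≃-trans (*L-comm (r +L s) p) (≃-trans (*L-distribˡ p r s) (+L-cong (*L-comm p r) (*L-comm p s)))

  ≃-isCommutativeRing : IsCommutativeRing _≃_ _+L_ _*L_ -L_ 0L 1L
  ≃-isCommutativeRing = record
    { isRing = record
      { +-isAbelianGroup = record
        { isGroup = record
          { isMonoid = record
            { isSemigroup = record
              { isMagma = record
                { isEquivalence = record { refl = ≃-refl ; sym = ≃-sym ; trans = ≃-trans }
                ; ∙-cong = +L-cong }
              ; assoc = +L-assoc }
            ; identity = +L-identityˡ , +L-identityʳ }
          ; inverse = -L-inverseˡ , -L-inverseʳ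
          ; ⁻¹-cong = -L-cong }
        ; comm = +L-comm }
      ; *-cong = *L-cong
      ; *-assoc = *L-assoc
      ; *-identity = *L-identityˡ , *L-identityʳ
      ; distrib = *L-distribˡ , *L-distribʳ }
    ; *-comm = *L-comm }

  commutativeRing : CommutativeRing _ _
  commutativeRing = record { isCommutativeRing = ≃-isCommutativeRing }

  nth-zeros : ∀ {cs} → All (_≡ + 0) cs → ∀ j → nth cs j ≡ + 0
  nth-zeros All.[]         j       = refl
  nth-zeros (z All.∷ zs) zero    = z
  nth-zeros (z All.∷ zs) (suc j) = nth-zeros zs j

  isZero? : ∀ p → Maybe (0L ≃ p)
  isZero? (mkL a cs) with all? (λ c → c ℤ.≟ + 0) cs
  ... | yes zs = just (coeffwise λ k → trans (coeff-zero (+ 0) k) (sym (trans (coeff-nthℤ a cs k) (nthℤ-zeros zs (k - a)))))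
    where
    nthℤ-zeros : ∀ {cs} → All (_≡ + 0) cs → ∀ i → nthℤ cs i ≡ + 0
    nthℤ-zeros zs (+ j)    = nth-zeros zs j
    nthℤ-zeros zs -[1+ j ] = refl
  ... | no _  = nothing

  almostCommutativeRing : AlmostCommutativeRing _ _
  almostCommutativeRing = fromCommutativeRing commutativeRing isZero?

  coeff-barL : ∀ p k → coeff (barL p) k ≡ coeff p (- k)
  coeff-barL (mkL a cs) k = begin
    coeff (mkL ((- (a + l)) + + 1) (reverse cs)) k  ≡⟨ coeff-nthℤ _ _ k ⟩
    nthℤ (reverse cs) (k - ((- (a + l)) + + 1))     ≡⟨ nthℤ-reverse cs _ ⟩
    nthℤ cs ((l - + 1) - (k - ((- (a + l)) + + 1))) ≡⟨ cong (nthℤ cs) (reflect k a l) ⟩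
    nthℤ cs (- k - a)                               ≡⟨ sym (coeff-nthℤ a cs (- k)) ⟩
    coeff (mkL a cs) (- k)                          ∎
    where
    l = + length cs
    reflect : ∀ k a l → (l - + 1) - (k - ((- (a + l)) + + 1)) ≡ - k - a
    reflect = solve-∀

  barL-cong : ∀ {p r} → p ≃ r → barL p ≃ barL r
  barL-cong {p} {r} e = coeffwise λ k → trans (coeff-barL p k) (trans (get e (- k)) (sym (coeff-barL r k)))

  barL-+L : ∀ p r → barL (p +L r) ≃ (barL p +L barL r)
  barL-+L p r = coeffwise λ k →
    trans (coeff-barL (p +L r) k)
      (trans (coeff-+L p r (- k))
        (trans (sym (cong₂ _+_ (coeff-barL p k) (coeff-barL r k))) (sym (coeff-+L (barL p) (barL r) k))))

  barL--L : ∀ p → barL (-L p) ≃ (-L barL p)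
  barL--L p = coeffwise λ k →
    trans (coeff-barL (-L p) k)
      (trans (coeff--L p (- k)) (trans (cong -_ (sym (coeff-barL p k))) (sym (coeff--L (barL p) k))))

  barL-0L : barL 0L ≃ 0L
  barL-0L = mkL-[]-cong

  mkL-split : ∀ a x xs → mkL a (x ∷ xs) ≃ (mkL a (x ∷ []) +L mkL (a + + 1) xs)
  mkL-split a x xs = coeffwise λ k → begin
    coeff (mkL a (x ∷ xs)) k
      ≡⟨ coeff-nthℤ a _ k ⟩
    nthℤ ((x ∷ []) ++ xs) (k - a)
      ≡⟨ nthℤ-++ (x ∷ []) xs (k - a) ⟩
    nthℤ (x ∷ []) (k - a) + nthℤ xs ((k - a) - + 1)
      ≡⟨ cong₂ _+_ (sym (coeff-nthℤ a _ k)) (trans (cong (nthℤ xs) (shift k a)) (sym (coeff-nthℤ _ xs k))) ⟩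
    coeff (mkL a (x ∷ [])) k + coeff (mkL (a + + 1) xs) k
      ≡⟨ sym (coeff-+L (mkL a (x ∷ [])) _ k) ⟩
    coeff (mkL a (x ∷ []) +L mkL (a + + 1) xs) k ∎
    where
    shift : ∀ k a → (k - a) - + 1 ≡ k - (a + + 1)
    shift = solve-∀

  barL-monomial*L : ∀ a x r → barL (mkL a (x ∷ []) *L r) ≃ (barL (mkL a (x ∷ [])) *L barL r)
  barL-monomial*L a x r = coeffwise λ k → begin
    coeff (barL (mkL a (x ∷ []) *L r)) k ≡⟨ coeff-barL _ k ⟩
    coeff (mkL a (x ∷ []) *L r) (- k)    ≡⟨ coeff-monomial*L a x r (- k) ⟩
    x * coeff r (- k - a)                ≡⟨ cong (λ t → x * coeff r t) (reflect k a) ⟩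
    x * coeff r (- (k - a'))             ≡⟨ cong (x *_) (sym (coeff-barL r (k - a'))) ⟩
    x * coeff (barL r) (k - a')          ≡⟨ sym (coeff-monomial*L _ x (barL r) k) ⟩
    coeff (mkL a' (x ∷ []) *L barL r) k  ∎
    where
    a' = (- (a + + 1)) + + 1
    reflect : ∀ k a → - k - a ≡ - (k - ((- (a + + 1)) + + 1))
    reflect = solve-∀

  barL-*L : ∀ p r → barL (p *L r) ≃ (barL p *L barL r)
  barL-*L (mkL a xs) r@(mkL _ _) = go a xs
    where
    go : ∀ a xs → barL (mkL a xs *L r) ≃ (barL (mkL a xs) *L barL r)
    go a []       = mkL-[]-cong
    go a (x ∷ xs) =
      ≃-trans (barL-cong (*L-congˡ r (mkL-split a x xs)))
      (≃-trans (barL-cong (*L-distribʳ r (mkL a (x ∷ [])) (mkL (a + + 1) xs)))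
      (≃-trans (barL-+L (mkL a (x ∷ []) *L r) (mkL (a + + 1) xs *L r))
      (≃-trans (+L-cong (barL-monomial*L a x r) (go (a + + 1) xs))
      (≃-trans (≃-sym (*L-distribʳ (barL r) (barL (mkL a (x ∷ []))) (barL (mkL (a + + 1) xs))))
      (*L-congˡ (barL r) (≃-trans (≃-sym (barL-+L (mkL a (x ∷ [])) (mkL (a + + 1) xs)))
                                   (barL-cong (≃-sym (mkL-split a x xs)))))))))

  barL-qˆ : ∀ a → barL (qˆ a) ≃ qˆ (- a)
  barL-qˆ a = coeffwise λ k → begin
    coeff (barL (qˆ a)) k         ≡⟨ coeff-barL (qˆ a) k ⟩
    coeff (qˆ a) (- k)            ≡⟨ coeff-nthℤ a _ (- k) ⟩
    nthℤ (+ 1 ∷ []) (- k - a)     ≡⟨ nthℤ-single (+ 1) (- k - a) ⟩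
    nthℤ (+ 1 ∷ []) (- (- k - a)) ≡⟨ cong (nthℤ (+ 1 ∷ [])) (reflect k a) ⟩
    nthℤ (+ 1 ∷ []) (k - - a)     ≡⟨ sym (coeff-nthℤ (- a) _ k) ⟩
    coeff (qˆ (- a)) k            ∎
    where
    reflect : ∀ k a → - (- k - a) ≡ k - - a
    reflect = solve-∀

  qˆ-+ : ∀ a b → (qˆ a *L qˆ b) ≃ qˆ (a + b)
  qˆ-+ a b = mkL-cong (mulP-identityˡ (+ 1 ∷ []))

  qˆ-cong : ∀ {a b} → a ≡ b → qˆ a ≃ qˆ b
  qˆ-cong refl = ≃-refl

module CoxeterCombinatorics (C : FiniteCoxeterSystem) where

  open import Level using (0ℓ)
  open import Data.Nat as ℕ using (ℕ; zero; suc; _+_; _≤_; _<_; z≤n)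
  import Data.Nat.Properties as NP
  open import Data.Fin using (Fin; toℕ)
  open import Data.Fin.Properties using () renaming (_≟_ to _≟F_)
  import Data.Fin.Properties as FP
  open import Data.List as List using (List; []; _∷_; _++_; length; reverse; filter; take; drop)
  import Data.List.Properties as LP
  open import Data.List.Relation.Unary.Any as Any using (any?; here)
  open import Data.List.Membership.Propositional using (_∈_; find; lose)
  import Data.List.Membership.Propositional.Properties as MP
  open import Data.Bool using (Bool; true; false; if_then_else_)
  open import Data.Product using (Σ; _×_; _,_; proj₁; proj₂)
  open import Data.Empty using (⊥; ⊥-elim)
  open import Relation.Nullary using (does; yes; no)
  open import Relation.Nullary.Decidable using (dec-true)
  open import Relation.Binary.PropositionalEquality
  open import Algebra.Bundles using (Group)
  open import Algebra.Structures using (IsGroup)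

  open Hecke C
  open IsGroup isGroup using (assoc; identityˡ; identityʳ)

  W-group : Group 0ℓ 0ℓ
  W-group = record { isGroup = isGroup }

  open import Algebra.Properties.Group W-group public
    using (⁻¹-anti-homo-∙; ⁻¹-involutive; ∙-cancelˡ; ∙-cancelʳ; ε⁻¹≈ε)
  open import Algebra.Properties.Group W-group using (inverseʳ-unique)

  s·s : ∀ i → s i · s i ≡ e
  s·s i = trans (sym (identityʳ (s i · s i))) (subst (λ k → powOp _·_ e (s i · s i) k ≡ e) (m-diag i) (relations i i))

  s⁻¹ : ∀ i → s i ⁻¹ ≡ s i
  s⁻¹ i = sym (inverseʳ-unique (s i) (s i) (s·s i))

  ·s·s : ∀ x i → (x · s i) · s i ≡ x
  ·s·s x i = trans (assoc _ _ _) (trans (cong (x ·_) (s·s i)) (identityʳ x))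

  s·s· : ∀ x i → s i · (s i · x) ≡ x
  s·s· x i = trans (sym (assoc _ _ _)) (trans (cong (_· x) (s·s i)) (identityˡ x))

  [s·x]⁻¹ : ∀ i x → (s i · x) ⁻¹ ≡ (x ⁻¹) · s i
  [s·x]⁻¹ i x = trans (⁻¹-anti-homo-∙ (s i) x) (cong ((x ⁻¹) ·_) (s⁻¹ i))

  [x·s]⁻¹ : ∀ x i → (x · s i) ⁻¹ ≡ s i · (x ⁻¹)
  [x·s]⁻¹ x i = trans (⁻¹-anti-homo-∙ x (s i)) (cong (_· (x ⁻¹)) (s⁻¹ i))

  prod-++ : ∀ a b → prod (a ++ b) ≡ prod a · prod b
  prod-++ []      b = sym (identityˡ _)
  prod-++ (i ∷ a) b = trans (cong (s i ·_) (prod-++ a b)) (sym (assoc _ _ _))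

  prod-∷ʳ : ∀ a i → prod (a ++ (i ∷ [])) ≡ prod a · s i
  prod-∷ʳ a i = trans (prod-++ a (i ∷ [])) (cong (prod a ·_) (identityʳ (s i)))

  prod-reverse : ∀ a → prod (reverse a) ≡ prod a ⁻¹
  prod-reverse []      = sym ε⁻¹≈ε
  prod-reverse (i ∷ a) = begin
    prod (reverse (i ∷ a))       ≡⟨ cong prod (LP.unfold-reverse i a) ⟩
    prod (reverse a ++ (i ∷ [])) ≡⟨ prod-∷ʳ (reverse a) i ⟩
    prod (reverse a) · s i       ≡⟨ cong (_· s i) (prod-reverse a) ⟩
    (prod a ⁻¹) · s i            ≡⟨ sym ([s·x]⁻¹ i (prod a)) ⟩
    (s i · prod a) ⁻¹            ∎
    where open ≡-Reasoning

  HasLength : W → ℕ → Set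
  HasLength x k = Σ (List (Fin r)) λ wd → length wd ≡ k × prod wd ≡ x

  hasWordOfLength : W → ℕ → Bool
  hasWordOfLength x k = does (any? (λ wd → prod wd ≟F x) (allWords k))

  search : W → ℕ → ℕ → ℕ
  search x zero    k = k
  search x (suc f) k = if hasWordOfLength x k then k else search x f (suc k)

  -- ℓ is defined by a local (unnameable) loop; abstracting over its fuel and start value
  -- lets the motive of this induction be inferred from the goal.
  ℓ≡search : ∀ x → ℓ x ≡ search x n 0
  ℓ≡search x with n | 0 | induction (λ k → refl) (λ m ih k → cong (if hasWordOfLength x k then k else_) (ih (suc k)))
    where
    induction : {P : ℕ → ℕ → Set} → (∀ k → P zero k) → (∀ m → (∀ k → P m k) → ∀ k → P (suc m) k) → ∀ m k → P m k
    induction base step zero    k = base k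
    induction base step (suc m) k = step m (induction base step m) k
  ... | m | k | h = h m k

  allWords-complete : ∀ wd → wd ∈ allWords (length wd)
  allWords-complete []       = here refl
  allWords-complete (i ∷ wd) =
    MP.∈-concatMap⁺ (λ j → List.map (j ∷_) (allWords (length wd)))
      (Any.map (λ { refl → MP.∈-map⁺ (i ∷_) (allWords-complete wd) }) (MP.∈-allFin i))

  allWords-sound : ∀ k wd → wd ∈ allWords k → length wd ≡ k
  allWords-sound zero    wd (here refl) = refl
  allWords-sound (suc k) wd p with Any.satisfied (MP.∈-concatMap⁻ (λ i → List.map (i ∷_) (allWords k)) {xs = List.allFin r} p)
  ... | i , q with MP.∈-map⁻ (i ∷_) q
  ... | wd' , q' , refl = cong suc (allWords-sound k wd' q')

  hasWordOfLength⇒ : ∀ x k → hasWordOfLength x k ≡ true → HasLength x k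
  hasWordOfLength⇒ x k p with any? (λ wd → prod wd ≟F x) (allWords k)
  ... | yes q with find q
  ...   | wd , mem , eq = wd , allWords-sound k wd mem , eq

  hasWordOfLength⇐ : ∀ x k → HasLength x k → hasWordOfLength x k ≡ true
  hasWordOfLength⇐ x k (wd , refl , eq) =
    dec-true (any? (λ wd → prod wd ≟F x) (allWords (length wd))) (lose (allWords-complete wd) eq)

  search-≤ : ∀ x f k j → k ≤ j → hasWordOfLength x j ≡ true → search x f k ≤ j
  search-≤ x zero    k j k≤j hj = k≤j
  search-≤ x (suc f) k j k≤j hj with hasWordOfLength x k in eq
  ... | true  = k≤j
  ... | false with k ℕ.≟ j
  ...   | yes refl = ⊥-elim (false≢true (trans (sym eq) hj))
    where
    false≢true : false ≢ true
    false≢true ()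
  ...   | no k≢j = search-≤ x f (suc k) j (NP.≤∧≢⇒< k≤j k≢j) hj

  search-succeeds : ∀ x f k j → k ≤ j → j < k + f → hasWordOfLength x j ≡ true →
                    hasWordOfLength x (search x f k) ≡ true
  search-succeeds x zero    k j k≤j j<k+0 hj = ⊥-elim (NP.<⇒≱ (subst (j <_) (NP.+-identityʳ k) j<k+0) k≤j)
  search-succeeds x (suc f) k j k≤j j<k+f hj with hasWordOfLength x k in eq
  ... | true  = eq
  ... | false with k ℕ.≟ j
  ...   | yes refl = ⊥-elim (false≢true (trans (sym eq) hj))
    where
    false≢true : false ≢ true
    false≢true ()
  ...   | no k≢j = search-succeeds x f (suc k) j (NP.≤∧≢⇒< k≤j k≢j) (subst (j <_) (NP.+-suc k f) j<k+f) hj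

  -- Pigeonhole on the n + 1 prefixes of a word of length ≥ n = |W|.
  shorten : ∀ wd → n ≤ length wd → Σ (List (Fin r)) λ wd' → prod wd' ≡ prod wd × length wd' < length wd
  shorten wd n≤l with FP.pigeonhole (NP.n<1+n n) (λ (i : Fin (suc n)) → prod (take (toℕ i) wd))
  ... | i , j , i<j , eq = take (toℕ i) wd ++ drop (toℕ j) wd , same-prod , shorter
    where
    i′ = toℕ i
    j′ = toℕ j
    j′≤l : j′ ≤ length wd
    j′≤l = NP.≤-trans (NP.≤-pred (FP.toℕ<n j)) n≤l
    same-prod : prod (take i′ wd ++ drop j′ wd) ≡ prod wd
    same-prod = begin
      prod (take i′ wd ++ drop j′ wd)       ≡⟨ prod-++ (take i′ wd) (drop j′ wd) ⟩
      prod (take i′ wd) · prod (drop j′ wd) ≡⟨ cong (_· prod (drop j′ wd)) eq ⟩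
      prod (take j′ wd) · prod (drop j′ wd) ≡⟨ sym (prod-++ (take j′ wd) (drop j′ wd)) ⟩
      prod (take j′ wd ++ drop j′ wd)       ≡⟨ cong prod (LP.take++drop≡id j′ wd) ⟩
      prod wd                               ∎
      where open ≡-Reasoning
    shorter : length (take i′ wd ++ drop j′ wd) < length wd
    shorter = begin-strict
      length (take i′ wd ++ drop j′ wd)         ≡⟨ LP.length-++ (take i′ wd) ⟩
      length (take i′ wd) + length (drop j′ wd) ≡⟨ cong₂ _+_ (LP.length-take i′ wd) (LP.length-drop j′ wd) ⟩
      (i′ ℕ.⊓ length wd) + (length wd ℕ.∸ j′)   ≤⟨ NP.+-monoˡ-≤ (length wd ℕ.∸ j′) (NP.m⊓n≤m i′ (length wd)) ⟩
      i′ + (length wd ℕ.∸ j′)                   <⟨ NP.+-monoˡ-< (length wd ℕ.∸ j′) i<j ⟩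
      j′ + (length wd ℕ.∸ j′)                   ≡⟨ NP.m+[n∸m]≡n j′≤l ⟩
      length wd                                 ∎
      where open NP.≤-Reasoning

  shortWord : ∀ (fuel : ℕ) wd → length wd ≤ fuel →
              Σ (List (Fin r)) λ wd' → prod wd' ≡ prod wd × length wd' < n
  shortWord fuel wd l≤f with length wd ℕ.<? n
  ... | yes l<n = wd , refl , l<n
  shortWord zero       wd l≤f | no l≮n = ⊥-elim (l≮n (NP.≤-<-trans l≤f (NP.≤-<-trans z≤n (FP.toℕ<n e))))
  shortWord (suc fuel) wd l≤f | no l≮n with shorten wd (NP.≮⇒≥ l≮n)
  ... | wd' , p , lt with shortWord fuel wd' (NP.≤-pred (NP.≤-trans lt l≤f))
  ...   | wd'' , p' , lt' = wd'' , trans p' p , lt'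

  ℓ-attained : ∀ x → HasLength x (ℓ x)
  ℓ-attained x with generated x
  ... | wd₀ , p₀ with shortWord (length wd₀) wd₀ NP.≤-refl
  ...   | wd , p , lt =
    subst (HasLength x) (sym (ℓ≡search x))
      (hasWordOfLength⇒ x (search x n 0)
        (search-succeeds x n 0 (length wd) z≤n lt (hasWordOfLength⇐ x (length wd) (wd , refl , trans p p₀))))

  ℓ-minimal : ∀ x wd → prod wd ≡ x → ℓ x ≤ length wd
  ℓ-minimal x wd p =
    subst (_≤ length wd) (sym (ℓ≡search x)) (search-≤ x n 0 (length wd) z≤n (hasWordOfLength⇐ x (length wd) (wd , refl , p)))

  reducedWord-spec : ∀ w → prod (reducedWord w) ≡ w × length (reducedWord w) ≡ ℓ w
  reducedWord-spec w with filter (λ wd → prod wd ≟F w) (allWords (ℓ w)) in eq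
  ... | [] with ℓ-attained w
  ...   | wd , len , p = ⊥-elim (∉[] (subst (wd ∈_) eq (MP.∈-filter⁺ (λ wd → prod wd ≟F w)
                                   (subst (λ k → wd ∈ allWords k) len (allWords-complete wd)) p)))
    where
    ∉[] : wd ∈ [] → ⊥
    ∉[] ()
  reducedWord-spec w | wd ∷ _ with MP.∈-filter⁻ (λ wd → prod wd ≟F w) {xs = allWords (ℓ w)} (subst (wd ∈_) (sym eq) (here refl))
  ... | mem , p = p , allWords-sound (ℓ w) wd mem

  prod-reducedWord : ∀ w → prod (reducedWord w) ≡ w
  prod-reducedWord w = proj₁ (reducedWord-spec w)

  length-reducedWord : ∀ w → length (reducedWord w) ≡ ℓ w
  length-reducedWord w = proj₂ (reducedWord-spec w)

  ℓ-e : ℓ e ≡ 0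
  ℓ-e = NP.n≤0⇒n≡0 (ℓ-minimal e [] refl)

  reducedWord-e : reducedWord e ≡ []
  reducedWord-e with reducedWord e | length-reducedWord e
  ... | []     | _ = refl
  ... | _ ∷ _  | p with trans p ℓ-e
  ...   | ()

  ℓ-⁻¹-≤ : ∀ x → ℓ (x ⁻¹) ≤ ℓ x
  ℓ-⁻¹-≤ x = subst (ℓ (x ⁻¹) ≤_) (trans (LP.length-reverse (reducedWord x)) (length-reducedWord x))
    (ℓ-minimal (x ⁻¹) (reverse (reducedWord x)) (trans (prod-reverse (reducedWord x)) (cong _⁻¹ (prod-reducedWord x))))

  ℓ-⁻¹ : ∀ x → ℓ (x ⁻¹) ≡ ℓ x
  ℓ-⁻¹ x = NP.≤-antisym (ℓ-⁻¹-≤ x) (subst (λ y → ℓ y ≤ ℓ (x ⁻¹)) (⁻¹-involutive x) (ℓ-⁻¹-≤ (x ⁻¹)))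

  ℓ-·s-≤ : ∀ x i → ℓ (x · s i) ≤ suc (ℓ x)
  ℓ-·s-≤ x i =
    subst (ℓ (x · s i) ≤_)
      (trans (LP.length-++ (reducedWord x)) (trans (NP.+-comm (length (reducedWord x)) 1) (cong suc (length-reducedWord x))))
      (ℓ-minimal (x · s i) (reducedWord x ++ (i ∷ [])) (trans (prod-∷ʳ (reducedWord x) i) (cong (_· s i) (prod-reducedWord x))))

  ℓ-s·-≤ : ∀ x i → ℓ (s i · x) ≤ suc (ℓ x)
  ℓ-s·-≤ x i = subst (ℓ (s i · x) ≤_) (cong suc (length-reducedWord x))
    (ℓ-minimal (s i · x) (i ∷ reducedWord x) (cong (s i ·_) (prod-reducedWord x)))

module ExchangeCondition (C : FiniteCoxeterSystem) where

  open import Level using (0ℓ)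
  open import Data.Nat using (ℕ; zero; suc; _+_; _≤_; _<_; s≤s)
  import Data.Nat.Properties as NP
  open import Data.Fin as Fin using (Fin)
  open import Data.Fin.Properties using () renaming (_≟_ to _≟F_)
  open import Data.List using (List; []; _∷_; _++_; length; removeAt)
  import Data.List.Properties as LP
  open import Data.Bool using (Bool; true; false; not; _xor_)
  open import Data.Bool.Properties using (xor-assoc; xor-same; xor-identityʳ)
  open import Data.Product using (Σ; _×_; _,_; proj₁; proj₂)
  open import Data.Sum using (_⊎_; inj₁; inj₂)
  open import Data.Empty using (⊥-elim)
  open import Function.Bundles using (mk⇔)
  open import Relation.Nullary using (does; yes; no)
  open import Relation.Nullary.Decidable using (dec-true; does-⇔)
  open import Relation.Binary.PropositionalEquality
  open import Algebra.Bundles using (Group)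
  open import Algebra.Structures using (IsGroup)

  open Hecke C
  open CoxeterCombinatorics C
  open IsGroup isGroup using (assoc; identityˡ; identityʳ; inverseˡ; inverseʳ)
  import Algebra.Solver.Monoid (Group.monoid W-group) as Monoid
  open Monoid using (_⊕_; _⊜_)

  _^_ : W → ℕ → W
  a ^ k = powOp _·_ e a k

  ^-comm : ∀ a k → (a ^ k) · a ≡ a · (a ^ k)
  ^-comm a zero    = trans (identityˡ a) (sym (identityʳ a))
  ^-comm a (suc k) = trans (assoc _ _ _) (cong (a ·_) (^-comm a k))

  ^-+ : ∀ a k l → a ^ (k + l) ≡ (a ^ k) · (a ^ l)
  ^-+ a zero    l = sym (identityˡ _)
  ^-+ a (suc k) l = trans (cong (a ·_) (^-+ a k l)) (sym (assoc _ _ _))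

  conj-e : ∀ t → e · (t · (e ⁻¹)) ≡ t
  conj-e t = trans (identityˡ _) (trans (cong (t ·_) ε⁻¹≈ε) (identityʳ t))

  conj⇒ : ∀ a t u → a · (t · (a ⁻¹)) ≡ u → t ≡ (a ⁻¹) · (u · a)
  conj⇒ a t u p = begin
    t                                 ≡⟨ sym (trans (cong₂ (λ x y → x · (t · y)) (inverseˡ a) (inverseˡ a)) (conj-e' t)) ⟩
    ((a ⁻¹) · a) · (t · ((a ⁻¹) · a)) ≡⟨ Monoid.solve 3 (λ A B T → (A ⊕ B) ⊕ (T ⊕ (A ⊕ B)) ⊜ A ⊕ ((B ⊕ (T ⊕ A)) ⊕ B)) refl (a ⁻¹) a t ⟩
    (a ⁻¹) · ((a · (t · (a ⁻¹))) · a) ≡⟨ cong (λ z → (a ⁻¹) · (z · a)) p ⟩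
    (a ⁻¹) · (u · a)                  ∎
    where
    open ≡-Reasoning
    conj-e' : ∀ t → e · (t · e) ≡ t
    conj-e' t = trans (identityˡ _) (identityʳ t)

  conj⇐ : ∀ a t u → t ≡ (a ⁻¹) · (u · a) → a · (t · (a ⁻¹)) ≡ u
  conj⇐ a t u refl = begin
    a · (((a ⁻¹) · (u · a)) · (a ⁻¹)) ≡⟨ Monoid.solve 3 (λ A B U → A ⊕ ((B ⊕ (U ⊕ A)) ⊕ B) ⊜ (A ⊕ B) ⊕ (U ⊕ (A ⊕ B))) refl a (a ⁻¹) u ⟩
    (a · (a ⁻¹)) · (u · (a · (a ⁻¹))) ≡⟨ cong₂ (λ z z' → z · (u · z')) (inverseʳ a) (inverseʳ a) ⟩
    e · (u · e)                       ≡⟨ trans (identityˡ _) (identityʳ u) ⟩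
    u                                 ∎
    where open ≡-Reasoning

  -- Tits' action of W on reflections × {±1}: (t , b) stands for (t , (-1)^b).  The first
  -- component ranges over all of W, which costs nothing and avoids defining reflections.
  Root : Set
  Root = W × Bool

  σ : Fin r → Root → Root
  σ i (t , b) = (s i · (t · s i) , b xor does (t ≟F s i))

  s·t·s≡s : ∀ i t → s i · (t · s i) ≡ s i → t ≡ s i
  s·t·s≡s i t p = ∙-cancelʳ (s i) t (s i) (∙-cancelˡ (s i) _ _ (trans p (sym (s·s· (s i) i))))

  σ-involutive : ∀ i z → σ i (σ i z) ≡ z
  σ-involutive i (t , b) = cong₂ _,_ conjugate-back sign-back
    where
    conjugate-back : s i · ((s i · (t · s i)) · s i) ≡ t
    conjugate-back = trans (cong (s i ·_) (trans (assoc _ _ _) (cong (s i ·_) (·s·s t i)))) (s·s· t i)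
    fixes-s : does ((s i · (t · s i)) ≟F s i) ≡ does (t ≟F s i)
    fixes-s = does-⇔ (mk⇔ (s·t·s≡s i t) (λ { refl → trans (cong (s i ·_) (s·s i)) (identityʳ (s i)) }))
                (_ ≟F s i) (t ≟F s i)
    sign-back : (b xor does (t ≟F s i)) xor does ((s i · (t · s i)) ≟F s i) ≡ b
    sign-back = trans (cong ((b xor does (t ≟F s i)) xor_) fixes-s)
      (trans (xor-assoc b _ _) (trans (cong (b xor_) (xor-same (does (t ≟F s i)))) (xor-identityʳ b)))

  record Perm : Set where
    field
      to from : Root → Root
      to∘from : ∀ z → to (from z) ≡ z
      from∘to : ∀ z → from (to z) ≡ z
  open Perm

  _≈P_ : Perm → Perm → Set
  f ≈P g = ∀ z → to f z ≡ to g z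

  _∘P_ : Perm → Perm → Perm
  f ∘P g = record
    { to = λ z → to f (to g z) ; from = λ z → from g (from f z)
    ; to∘from = λ z → trans (cong (to f) (to∘from g (from f z))) (to∘from f z)
    ; from∘to = λ z → trans (cong (from g) (from∘to f (to g z))) (from∘to g z) }

  idP : Perm
  idP = record { to = λ z → z ; from = λ z → z ; to∘from = λ z → refl ; from∘to = λ z → refl }

  Perm-group : Group 0ℓ 0ℓ
  Perm-group = record
    { Carrier = Perm ; _≈_ = _≈P_ ; _∙_ = _∘P_ ; ε = idP
    ; _⁻¹ = λ f → record { to = from f ; from = to f ; to∘from = from∘to f ; from∘to = to∘from f }
    ; isGroup = record
      { isMonoid = record
        { isSemigroup = record
          { isMagma = record
            { isEquivalence = record { refl = λ z → refl ; sym = λ p z → sym (p z) ; trans = λ p q z → trans (p z) (q z) }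
            ; ∙-cong = λ {f} {f'} {g} {g'} p q z → trans (cong (to f) (q z)) (p (to g' z)) }
          ; assoc = λ f g h z → refl }
        ; identity = (λ f z → refl) , (λ f z → refl) }
      ; inverse = (λ f z → from∘to f z) , (λ f z → to∘from f z)
      ; ⁻¹-cong = λ {f} {g} p z → trans (sym (from∘to g (from f z))) (cong (from g) (trans (sym (p (from f z))) (to∘from f z))) } }

  σ-perm : Fin r → Perm
  σ-perm i = record { to = σ i ; from = σ i ; to∘from = σ-involutive i ; from∘to = σ-involutive i }

  -- (σᵢ σⱼ)ᵏ conjugates by cᵏ, where c = sᵢ sⱼ, and flips the sign exactly when the first component
  -- is one of the 2k elements sⱼ c^0, …, sⱼ c^(2k-1); since c^m = e this list repeats itself with
  -- period m, so at k = m every sign is flipped an even number of times.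
  module DihedralRelation (i j : Fin r) where

    c : W
    c = s i · s j

    flips : ℕ → W → Bool
    flips zero    t = false
    flips (suc a) t = flips a t xor does (t ≟F (s j · (c ^ a)))

    c⁻¹ : c ⁻¹ ≡ s j · s i
    c⁻¹ = trans (⁻¹-anti-homo-∙ (s i) (s j)) (cong₂ _·_ (s⁻¹ j) (s⁻¹ i))

    [c·cᵏ]⁻¹ : ∀ k → (c · (c ^ k)) ⁻¹ ≡ ((c ^ k) ⁻¹) · (s j · s i)
    [c·cᵏ]⁻¹ k = trans (⁻¹-anti-homo-∙ c (c ^ k)) (cong ((c ^ k) ⁻¹ ·_) c⁻¹)

    conj-sj : ∀ k → ((c ^ k) ⁻¹) · (s j · (c ^ k)) ≡ s j · (c ^ (k + k))
    conj-sj zero    = trans (cong (_· (s j · e)) ε⁻¹≈ε) (identityˡ _)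
    conj-sj (suc k) = begin
      ((c · (c ^ k)) ⁻¹) · (s j · (c · (c ^ k)))
        ≡⟨ cong (_· (s j · (c · (c ^ k)))) ([c·cᵏ]⁻¹ k) ⟩
      (((c ^ k) ⁻¹) · (s j · s i)) · (s j · ((s i · s j) · (c ^ k)))
        ≡⟨ Monoid.solve 4 (λ A Y X B → (A ⊕ (Y ⊕ X)) ⊕ (Y ⊕ ((X ⊕ Y) ⊕ B)) ⊜ A ⊕ (Y ⊕ ((X ⊕ Y) ⊕ ((X ⊕ Y) ⊕ B)))) refl ((c ^ k) ⁻¹) (s j) (s i) (c ^ k) ⟩
      ((c ^ k) ⁻¹) · (s j · (c · (c · (c ^ k))))
        ≡⟨ cong (λ z → ((c ^ k) ⁻¹) · (s j · z)) (sym (c·c·cᵏ k)) ⟩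
      ((c ^ k) ⁻¹) · (s j · (((c ^ k) · c) · c))
        ≡⟨ Monoid.solve 4 (λ A Y B P → A ⊕ (Y ⊕ ((B ⊕ P) ⊕ P)) ⊜ (A ⊕ (Y ⊕ B)) ⊕ (P ⊕ P)) refl ((c ^ k) ⁻¹) (s j) (c ^ k) c ⟩
      (((c ^ k) ⁻¹) · (s j · (c ^ k))) · (c · c)
        ≡⟨ cong (_· (c · c)) (conj-sj k) ⟩
      (s j · (c ^ (k + k))) · (c · c)
        ≡⟨ Monoid.solve 3 (λ Y B P → (Y ⊕ B) ⊕ (P ⊕ P) ⊜ Y ⊕ ((B ⊕ P) ⊕ P)) refl (s j) (c ^ (k + k)) c ⟩
      s j · (((c ^ (k + k)) · c) · c)
        ≡⟨ cong (s j ·_) (c·c·cᵏ (k + k)) ⟩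
      s j · (c ^ suc (suc (k + k)))
        ≡⟨ cong (λ z → s j · (c ^ suc z)) (sym (NP.+-suc k k)) ⟩
      s j · (c ^ (suc k + suc k)) ∎
      where
      open ≡-Reasoning
      c·c·cᵏ : ∀ k → ((c ^ k) · c) · c ≡ c · (c · (c ^ k))
      c·c·cᵏ k = trans (cong (_· c) (^-comm c k)) (trans (assoc _ _ _) (cong (c ·_) (^-comm c k)))

    conj-sjsisj : ∀ k → ((c ^ k) ⁻¹) · ((s j · (s i · s j)) · (c ^ k)) ≡ s j · (c ^ suc (k + k))
    conj-sjsisj k = begin
      ((c ^ k) ⁻¹) · ((s j · c) · (c ^ k)) ≡⟨ cong ((c ^ k) ⁻¹ ·_) (trans (assoc _ _ _) (cong (s j ·_) (sym (^-comm c k)))) ⟩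
      ((c ^ k) ⁻¹) · (s j · ((c ^ k) · c)) ≡⟨ Monoid.solve 4 (λ A Y B P → A ⊕ (Y ⊕ (B ⊕ P)) ⊜ (A ⊕ (Y ⊕ B)) ⊕ P) refl ((c ^ k) ⁻¹) (s j) (c ^ k) c ⟩
      (((c ^ k) ⁻¹) · (s j · (c ^ k))) · c ≡⟨ cong (_· c) (conj-sj k) ⟩
      (s j · (c ^ (k + k))) · c            ≡⟨ trans (assoc _ _ _) (cong (s j ·_) (^-comm c (k + k))) ⟩
      s j · (c ^ suc (k + k))              ∎
      where open ≡-Reasoning

    sj-unconj : ∀ x → s j · ((s j · (x · s j)) · s j) ≡ x
    sj-unconj x = trans (Monoid.solve 2 (λ Y X → Y ⊕ ((Y ⊕ (X ⊕ Y)) ⊕ Y) ⊜ (Y ⊕ Y) ⊕ (X ⊕ (Y ⊕ Y))) refl (s j) x)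
                    (trans (cong₂ (λ a b → a · (x · b)) (s·s j) (s·s j)) (trans (identityˡ _) (identityʳ x)))

    sj-conj⇒ : ∀ x → s j · (x · s j) ≡ s i → x ≡ s j · (s i · s j)
    sj-conj⇒ x p = sym (trans (cong (λ z → s j · (z · s j)) (sym p)) (sj-unconj x))

    sj-conj⇐ : ∀ x → x ≡ s j · (s i · s j) → s j · (x · s j) ≡ s i
    sj-conj⇐ x refl = sj-unconj (s i)

    flip-sj : ∀ k t → does (((c ^ k) · (t · ((c ^ k) ⁻¹))) ≟F s j) ≡ does (t ≟F (s j · (c ^ (k + k))))
    flip-sj k t = does-⇔ (mk⇔ (λ p → trans (conj⇒ (c ^ k) t (s j) p) (conj-sj k))
                              (λ p → conj⇐ (c ^ k) t (s j) (trans p (sym (conj-sj k)))))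
                  (_ ≟F s j) (t ≟F _)

    flip-si : ∀ k t → let x = (c ^ k) · (t · ((c ^ k) ⁻¹)) in
              does ((s j · (x · s j)) ≟F s i) ≡ does (t ≟F (s j · (c ^ suc (k + k))))
    flip-si k t = does-⇔ (mk⇔
      (λ p → trans (conj⇒ (c ^ k) t _ (sj-conj⇒ _ p)) (conj-sjsisj k))
      (λ p → sj-conj⇐ _ (conj⇐ (c ^ k) t _ (trans p (sym (conj-sjsisj k))))))
      (_ ≟F s i) (t ≟F _)

    σσ^ : ℕ → Root → Root
    σσ^ k = to (powOp _∘P_ idP (σ-perm i ∘P σ-perm j) k)

    σσ^-action : ∀ k t b → σσ^ k (t , b) ≡ ((c ^ k) · (t · ((c ^ k) ⁻¹)) , b xor flips (k + k) t)
    σσ^-action zero    t b = cong₂ _,_ (sym (conj-e t)) (sym (xor-identityʳ b))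
    σσ^-action (suc k) t b rewrite σσ^-action k t b = cong₂ _,_ conjugate signs
      where
      x = (c ^ k) · (t · ((c ^ k) ⁻¹))
      open ≡-Reasoning
      conjugate : s i · ((s j · (x · s j)) · s i) ≡ (c · (c ^ k)) · (t · ((c · (c ^ k)) ⁻¹))
      conjugate = begin
        s i · ((s j · (((c ^ k) · (t · ((c ^ k) ⁻¹))) · s j)) · s i)
          ≡⟨ Monoid.solve 5 (λ X Y B T A → X ⊕ ((Y ⊕ ((B ⊕ (T ⊕ A)) ⊕ Y)) ⊕ X) ⊜ ((X ⊕ Y) ⊕ B) ⊕ (T ⊕ (A ⊕ (Y ⊕ X)))) refl (s i) (s j) (c ^ k) t ((c ^ k) ⁻¹) ⟩
        (c · (c ^ k)) · (t · (((c ^ k) ⁻¹) · (s j · s i)))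
          ≡⟨ cong (λ z → (c · (c ^ k)) · (t · z)) (sym ([c·cᵏ]⁻¹ k)) ⟩
        (c · (c ^ k)) · (t · ((c · (c ^ k)) ⁻¹)) ∎
      signs : ((b xor flips (k + k) t) xor does (x ≟F s j)) xor does ((s j · (x · s j)) ≟F s i)
              ≡ b xor flips (suc k + suc k) t
      signs = begin
        ((b xor flips (k + k) t) xor does (x ≟F s j)) xor does ((s j · (x · s j)) ≟F s i)
          ≡⟨ cong₂ (λ u v → ((b xor flips (k + k) t) xor u) xor v) (flip-sj k t) (flip-si k t) ⟩
        ((b xor flips (k + k) t) xor does (t ≟F (s j · (c ^ (k + k))))) xor does (t ≟F (s j · (c ^ suc (k + k))))
          ≡⟨ trans (cong (_xor _) (xor-assoc b _ _)) (xor-assoc b _ _) ⟩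
        b xor flips (suc (suc (k + k))) t
          ≡⟨ cong (λ z → b xor flips (suc z) t) (sym (NP.+-suc k k)) ⟩
        b xor flips (suc k + suc k) t ∎

    flips-periodic : ∀ t a → flips (m i j + a) t ≡ flips (m i j) t xor flips a t
    flips-periodic t zero    = trans (cong (λ z → flips z t) (NP.+-identityʳ (m i j))) (sym (xor-identityʳ _))
    flips-periodic t (suc a) = begin
      flips (m i j + suc a) t
        ≡⟨ cong (λ z → flips z t) (NP.+-suc (m i j) a) ⟩
      flips (m i j + a) t xor does (t ≟F (s j · (c ^ (m i j + a))))
        ≡⟨ cong₂ (λ u v → u xor does (t ≟F (s j · v))) (flips-periodic t a)
                 (trans (^-+ c (m i j) a) (trans (cong (_· (c ^ a)) (relations i j)) (identityˡ _))) ⟩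
      (flips (m i j) t xor flips a t) xor does (t ≟F (s j · (c ^ a)))
        ≡⟨ xor-assoc (flips (m i j) t) _ _ ⟩
      flips (m i j) t xor flips (suc a) t ∎
      where open ≡-Reasoning

    relation : ∀ z → σσ^ (m i j) z ≡ z
    relation (t , b) = trans (σσ^-action (m i j) t b) (cong₂ _,_ conjugate-back sign-back)
      where
      conjugate-back : (c ^ m i j) · (t · ((c ^ m i j) ⁻¹)) ≡ t
      conjugate-back rewrite relations i j = conj-e t
      sign-back : b xor flips (m i j + m i j) t ≡ b
      sign-back = trans (cong (b xor_) (trans (flips-periodic t (m i j)) (xor-same (flips (m i j) t))))
                        (xor-identityʳ b)

  private
    tits = universal Perm-group σ-perm (λ i j → DihedralRelation.relation i j)

  φ : W → Perm
  φ = proj₁ tits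

  φ-hom : ∀ a b → φ (a · b) ≈P (φ a ∘P φ b)
  φ-hom = proj₁ (proj₂ tits)

  φ-s : ∀ i → φ (s i) ≈P σ-perm i
  φ-s = proj₂ (proj₂ tits)

  φ-e : ∀ z → to (φ e) z ≡ z
  φ-e z = sym (begin
    z                                  ≡⟨ sym (from∘to (φ e) z) ⟩
    from (φ e) (to (φ e) z)            ≡⟨ cong (from (φ e)) (trans (cong (λ a → to (φ a) z) (sym (identityʳ e))) (φ-hom e e z)) ⟩
    from (φ e) (to (φ e) (to (φ e) z)) ≡⟨ from∘to (φ e) _ ⟩
    to (φ e) z                          ∎)
    where open ≡-Reasoning

  act : List (Fin r) → Root → Root
  act []      z = z
  act (i ∷ a) z = σ i (act a z)

  act-prod : ∀ a z → to (φ (prod a)) z ≡ act a z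
  act-prod []      z = φ-e z
  act-prod (i ∷ a) z = trans (φ-hom (s i) (prod a) z) (trans (φ-s i _) (cong (σ i) (act-prod a z)))

  act-++ : ∀ a b z → act (a ++ b) z ≡ act a (act b z)
  act-++ []      b z = refl
  act-++ (i ∷ a) b z = cong (σ i) (act-++ a b z)

  conj : List (Fin r) → W → W
  conj a t = prod a · (t · (prod a ⁻¹))

  parity : List (Fin r) → W → Bool
  parity []      t = false
  parity (i ∷ a) t = parity a t xor does (conj a t ≟F s i)

  act-form : ∀ a t b → act a (t , b) ≡ (conj a t , b xor parity a t)
  act-form []      t b = cong₂ _,_ (sym (conj-e t)) (sym (xor-identityʳ b))
  act-form (i ∷ a) t b rewrite act-form a t b = cong₂ _,_ conjugate (xor-assoc b _ _)
    where
    open ≡-Reasoning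
    conjugate : s i · ((prod a · (t · (prod a ⁻¹))) · s i) ≡ (s i · prod a) · (t · ((s i · prod a) ⁻¹))
    conjugate = begin
      s i · ((prod a · (t · (prod a ⁻¹))) · s i)
        ≡⟨ Monoid.solve 4 (λ S P T Q → S ⊕ ((P ⊕ (T ⊕ Q)) ⊕ S) ⊜ (S ⊕ P) ⊕ (T ⊕ (Q ⊕ S))) refl (s i) (prod a) t (prod a ⁻¹) ⟩
      (s i · prod a) · (t · ((prod a ⁻¹) · s i))
        ≡⟨ cong (λ z → (s i · prod a) · (t · z)) (sym ([s·x]⁻¹ i (prod a))) ⟩
      (s i · prod a) · (t · ((s i · prod a) ⁻¹)) ∎

  parity-via-act : ∀ a t → parity a t ≡ proj₂ (act a (t , false))
  parity-via-act a t = sym (cong proj₂ (act-form a t false))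

  parity-wd : ∀ a b t → prod a ≡ prod b → parity a t ≡ parity b t
  parity-wd a b t p = begin
    parity a t                ≡⟨ parity-via-act a t ⟩
    proj₂ (act a (t , false)) ≡⟨ cong proj₂ (trans (sym (act-prod a _)) (trans (cong (λ w → to (φ w) _) p) (act-prod b _))) ⟩
    proj₂ (act b (t , false)) ≡⟨ sym (parity-via-act b t) ⟩
    parity b t                ∎
    where open ≡-Reasoning

  parity-∷ʳ : ∀ a j → parity (a ++ (j ∷ [])) (s j) ≡ not (parity a (s j))
  parity-∷ʳ a j = begin
    parity (a ++ (j ∷ [])) (s j)              ≡⟨ parity-via-act (a ++ (j ∷ [])) (s j) ⟩
    proj₂ (act (a ++ (j ∷ [])) (s j , false)) ≡⟨ cong proj₂ (act-++ a (j ∷ []) (s j , false)) ⟩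
    proj₂ (act a (σ j (s j , false)))         ≡⟨ cong (λ z → proj₂ (act a z)) σ-s ⟩
    proj₂ (act a (s j , true))                ≡⟨ cong proj₂ (act-form a (s j) true) ⟩
    not (parity a (s j))                      ∎
    where
    open ≡-Reasoning
    σ-s : σ j (s j , false) ≡ (s j , true)
    σ-s = cong₂ _,_ (s·s· (s j) j) (dec-true (s j ≟F s j) refl)

  parity⇒deletion : ∀ a t → parity a t ≡ true → Σ (Fin (length a)) λ k → prod (removeAt a k) ≡ prod a · t
  parity⇒deletion []      t ()
  parity⇒deletion (i ∷ a) t p with parity a t in eq
  ... | true with parity⇒deletion a t eq
  ...   | k , q = Fin.suc k , trans (cong (s i ·_) q) (sym (assoc _ _ _))
  parity⇒deletion (i ∷ a) t p | false with conj a t ≟F s i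
  ...   | yes q = Fin.zero , sym deleted
    where
    w = prod a
    open ≡-Reasoning
    deleted : (s i · w) · t ≡ w
    deleted = begin
      (s i · w) · t                    ≡⟨ cong ((s i · w) ·_) (conj⇒ w t (s i) q) ⟩
      (s i · w) · ((w ⁻¹) · (s i · w)) ≡⟨ Monoid.solve 3 (λ S W' V → (S ⊕ W') ⊕ (V ⊕ (S ⊕ W')) ⊜ (S ⊕ (W' ⊕ V)) ⊕ (S ⊕ W')) refl (s i) w (w ⁻¹) ⟩
      (s i · (w · (w ⁻¹))) · (s i · w) ≡⟨ cong (λ z → (s i · z) · (s i · w)) (inverseʳ w) ⟩
      (s i · e) · (s i · w)            ≡⟨ cong (_· (s i · w)) (identityʳ (s i)) ⟩
      s i · (s i · w)                  ≡⟨ s·s· w i ⟩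
      w                                ∎
  parity⇒deletion (i ∷ a) t () | false | no _

  ℓ-removeAt : ∀ a k → suc (ℓ (prod (removeAt a k))) ≤ length a
  ℓ-removeAt a k = subst (suc (ℓ (prod (removeAt a k))) ≤_) (sym (LP.length-removeAt′ a k))
                     (s≤s (ℓ-minimal _ (removeAt a k) refl))

  parity⇒descent : ∀ w t → parity (reducedWord w) t ≡ true → ℓ (w · t) < ℓ w
  parity⇒descent w t p with parity⇒deletion (reducedWord w) t p
  ... | k , q = subst₂ (λ x y → suc (ℓ x) ≤ y) (trans q (cong (_· t) (prod-reducedWord w))) (length-reducedWord w)
                  (ℓ-removeAt (reducedWord w) k)

  ¬parity⇒ascent : ∀ w j → parity (reducedWord w) (s j) ≡ false → ℓ w < ℓ (w · s j)
  ¬parity⇒ascent w j p = subst (λ z → ℓ z < ℓ (w · s j)) (·s·s w j) (parity⇒descent (w · s j) (s j) flipped)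
    where
    open ≡-Reasoning
    flipped : parity (reducedWord (w · s j)) (s j) ≡ true
    flipped = begin
      parity (reducedWord (w · s j)) (s j)
        ≡⟨ parity-wd (reducedWord (w · s j)) (reducedWord w ++ (j ∷ [])) (s j)
             (trans (prod-reducedWord (w · s j)) (sym (trans (prod-∷ʳ (reducedWord w) j) (cong (_· s j) (prod-reducedWord w))))) ⟩
      parity (reducedWord w ++ (j ∷ [])) (s j)
        ≡⟨ parity-∷ʳ (reducedWord w) j ⟩
      not (parity (reducedWord w) (s j))
        ≡⟨ cong not p ⟩
      true ∎

  ℓ-·s : ∀ w j → (ℓ (w · s j) ≡ suc (ℓ w)) ⊎ (suc (ℓ (w · s j)) ≡ ℓ w)
  ℓ-·s w j with parity (reducedWord w) (s j) in eq
  ... | true  = inj₂ (NP.≤-antisym (parity⇒descent w (s j) eq)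
                                   (subst (λ z → ℓ z ≤ suc (ℓ (w · s j))) (·s·s w j) (ℓ-·s-≤ (w · s j) j)))
  ... | false = inj₁ (NP.≤-antisym (ℓ-·s-≤ w j) (¬parity⇒ascent w j eq))

  ℓ-s·≡ℓ-⁻¹·s : ∀ i w → ℓ (s i · w) ≡ ℓ ((w ⁻¹) · s i)
  ℓ-s·≡ℓ-⁻¹·s i w = trans (sym (ℓ-⁻¹ (s i · w))) (cong ℓ ([s·x]⁻¹ i w))

  ℓ-s· : ∀ w i → (ℓ (s i · w) ≡ suc (ℓ w)) ⊎ (suc (ℓ (s i · w)) ≡ ℓ w)
  ℓ-s· w i with ℓ-·s (w ⁻¹) i
  ... | inj₁ p = inj₁ (trans (ℓ-s·≡ℓ-⁻¹·s i w) (trans p (cong suc (ℓ-⁻¹ w))))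
  ... | inj₂ p = inj₂ (trans (cong suc (ℓ-s·≡ℓ-⁻¹·s i w)) (trans p (ℓ-⁻¹ w)))

  exchange : ∀ a j → ℓ (prod a · s j) < ℓ (prod a) → Σ (Fin (length a)) λ k → prod (removeAt a k) ≡ prod a · s j
  exchange a j lt with parity (reducedWord (prod a)) (s j) in eq
  ... | true  = parity⇒deletion a (s j) (trans (parity-wd a (reducedWord (prod a)) (s j) (sym (prod-reducedWord (prod a)))) eq)
  ... | false = ⊥-elim (NP.<-asym lt (¬parity⇒ascent (prod a) j eq))

  -- Exchanging s_j into the reduced word s_i · (reduced word of w) can only delete that s_i.
  s·w·s≡w : ∀ w i j → ℓ w < ℓ (s i · w) → ℓ w < ℓ (w · s j) → ℓ ((s i · w) · s j) < ℓ (s i · w) →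
            (s i · w) · s j ≡ w
  s·w·s≡w w i j w<sw w<ws sws<sw with exchange (i ∷ reducedWord w) j (subst (λ z → ℓ (z · s j) < ℓ z) (sym si·w) sws<sw)
    where
    si·w : prod (i ∷ reducedWord w) ≡ s i · w
    si·w = cong (s i ·_) (prod-reducedWord w)
  ... | Fin.zero  , q = sym (trans (sym (prod-reducedWord w)) (trans q (cong (λ z → (s i · z) · s j) (prod-reducedWord w))))
  ... | Fin.suc k , q = ⊥-elim (NP.<-asym w<ws ws<w)
    where
    q' : prod (removeAt (reducedWord w) k) ≡ w · s j
    q' = ∙-cancelˡ (s i) _ _ (trans q (trans (cong (λ z → (s i · z) · s j) (prod-reducedWord w)) (assoc _ _ _)))
    ws<w : ℓ (w · s j) < ℓ w
    ws<w = subst₂ (λ x y → suc (ℓ x) ≤ y) q' (length-reducedWord w) (ℓ-removeAt (reducedWord w) k)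

module HeckeOperators (C : FiniteCoxeterSystem) where

  open import Data.Nat as ℕ using (ℕ; zero; suc; _≤_; _<_; s≤s; _<ᵇ_)
  import Data.Nat.Properties as NP
  open import Data.Fin as Fin using (Fin)
  open import Data.Fin.Properties using () renaming (_≟_ to _≟F_)
  open import Data.List as List using (List; []; _∷_; _++_; length; foldl; foldr)
  import Data.List.Properties as LP
  open import Data.Bool using (Bool; true; false; if_then_else_)
  open import Function using (flip)
  open import Data.Sum using (inj₁; inj₂)
  open import Data.Empty using (⊥; ⊥-elim)
  open import Function.Bundles using (mk⇔)
  open import Relation.Nullary using (does)
  open import Relation.Nullary.Decidable using (does-⇔)
  open import Relation.Binary.PropositionalEquality
  open import Algebra.Bundles using (CommutativeRing)
  open import Algebra.Structures using (IsGroup)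
  open import Tactic.RingSolver using (solve-∀)

  open LaurentPolynomials hiding (_≋_)
  open Hecke C
  open CoxeterCombinatorics C
  open ExchangeCondition C using (ℓ-·s; ℓ-s·; s·w·s≡w)
  open IsGroup isGroup using (assoc)
  open import Algebra.Properties.Semiring.Sum (CommutativeRing.semiring commutativeRing)
    using (sum; sum-cong-≋; ∑-distrib-+; ∑-comm; *-distribˡ-sum; sum-replicate-zero)

  if-<ᵇ-true : ∀ {A : Set} {m n} {x y : A} → m < n → (if m <ᵇ n then x else y) ≡ x
  if-<ᵇ-true {m = zero}  {suc n} p       = refl
  if-<ᵇ-true {m = suc m} {suc n} (s≤s p) = if-<ᵇ-true p

  if-<ᵇ-false : ∀ {A : Set} {m n} {x y : A} → n ≤ m → (if m <ᵇ n then x else y) ≡ y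
  if-<ᵇ-false {m = m}     {zero}  p       = refl
  if-<ᵇ-false {m = suc m} {suc n} (s≤s p) = if-<ᵇ-false p

  sum-sumW : ∀ F x → sumW F x ≡ sum (λ w → F w x)
  sum-sumW F x = go (λ w → w)
    where
    go : ∀ {N} (g : Fin N → W) →
         foldr (λ w acc x → F w x +L acc x) (λ _ → 0L) (List.tabulate g) x ≡ sum (λ k → F (g k) x)
    go {zero}  g = refl
    go {suc N} g = cong (F (g Fin.zero) x +L_) (go (λ k → g (Fin.suc k)))

  sum-δ : ∀ {N} (u : Fin N) (b : Fin N → Laurent) → sum (λ w → if does (u ≟F w) then b w else 0L) ≃ b u
  sum-δ {suc N} Fin.zero    b = ≃-trans (+L-cong ≃-refl (sum-replicate-zero N)) (+L-identityʳ _)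
  sum-δ {suc N} (Fin.suc u) b = ≃-trans (+L-identityˡ _) (sum-δ u (λ k → b (Fin.suc k)))

  barL-sum : ∀ {N} (f : Fin N → Laurent) → barL (sum f) ≃ sum (λ k → barL (f k))
  barL-sum {zero}  f = barL-0L
  barL-sum {suc N} f = ≃-trans (barL-+L (f Fin.zero) _) (+L-cong ≃-refl (barL-sum (λ k → f (Fin.suc k))))

  infix 4 _≃H_
  _≃H_ : H → H → Set
  h ≃H h' = ∀ w → h w ≃ h' w

  ≃H-refl : ∀ {h} → h ≃H h
  ≃H-refl w = ≃-refl

  ≃H-reflexive : ∀ {h h'} → h ≡ h' → h ≃H h'
  ≃H-reflexive refl = ≃H-refl

  ≃H-sym : ∀ {h h'} → h ≃H h' → h' ≃H h
  ≃H-sym e w = ≃-sym (e w)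

  ≃H-trans : ∀ {h h' h''} → h ≃H h' → h' ≃H h'' → h ≃H h''
  ≃H-trans e f w = ≃-trans (e w) (f w)

  ⊙-cong : ∀ a {h h'} → h ≃H h' → (a ⊙ h) ≃H (a ⊙ h')
  ⊙-cong a e x = *L-congʳ a (e x)

  ⊙-congˡ : ∀ {a b} h → a ≃ b → (a ⊙ h) ≃H (b ⊙ h)
  ⊙-congˡ h e x = *L-congˡ (h x) e

  +H-cong : ∀ {h h' g g'} → h ≃H h' → g ≃H g' → (h +H g) ≃H (h' +H g')
  +H-cong e f x = +L-cong (e x) (f x)

  sumW-cong : ∀ {F G : W → H} → (∀ w → F w ≃H G w) → sumW F ≃H sumW G
  sumW-cong {F} {G} e x = subst₂ _≃_ (sym (sum-sumW F x)) (sym (sum-sumW G x)) (sum-cong-≋ (λ w → e w x))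

  linear : (W → H) → H → H
  linear K h = sumW (λ w → h w ⊙ K w)

  linear-sum : ∀ K h x → linear K h x ≡ sum (λ w → h w *L K w x)
  linear-sum K h x = sum-sumW (λ w → h w ⊙ K w) x

  linear-cong : ∀ K {h h'} → h ≃H h' → linear K h ≃H linear K h'
  linear-cong K e = sumW-cong (λ w x → *L-congˡ _ (e w))

  linear-congˡ : ∀ {K K'} h → (∀ w → K w ≃H K' w) → linear K h ≃H linear K' h
  linear-congˡ h e = sumW-cong (λ w x → *L-congʳ (h w) (e w x))

  linear-+H : ∀ K h h' → linear K (h +H h') ≃H (linear K h +H linear K h')
  linear-+H K h h' x = subst₂ _≃_ (sym (linear-sum K (h +H h') x)) (sym (cong₂ _+L_ (linear-sum K h x) (linear-sum K h' x)))
    (≃-trans (sum-cong-≋ (λ w → *L-distribʳ (K w x) (h w) (h' w)))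
             (∑-distrib-+ (λ w → h w *L K w x) (λ w → h' w *L K w x)))

  linear-⊙ : ∀ K a h → linear K (a ⊙ h) ≃H (a ⊙ linear K h)
  linear-⊙ K a h x = subst₂ _≃_ (sym (linear-sum K (a ⊙ h) x)) (sym (cong (a *L_) (linear-sum K h x)))
    (≃-trans (sum-cong-≋ (λ w → *L-assoc a (h w) (K w x))) (≃-sym (*-distribˡ-sum a (λ w → h w *L K w x))))

  linear-comb : ∀ K a g b g' → linear K ((a ⊙ g) +H (b ⊙ g')) ≃H ((a ⊙ linear K g) +H (b ⊙ linear K g'))
  linear-comb K a g b g' = ≃H-trans (linear-+H K (a ⊙ g) (b ⊙ g')) (+H-cong (linear-⊙ K a g) (linear-⊙ K b g'))

  if-then-1-else-0 : ∀ (b : Bool) c → (c *L (if b then 1L else 0L)) ≃ (if b then c else 0L)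
  if-then-1-else-0 true  c = *L-identityʳ c
  if-then-1-else-0 false c = ≃-trans (*L-comm c 0L) (*L-zeroˡ c)

  if-cong : ∀ {b b' : Bool} {u} → b ≡ b' → (if b then u else 0L) ≃ (if b' then u else 0L)
  if-cong refl = ≃-refl

  sum-reindex : ∀ (a : W → Laurent) (f f⁻ : W → W) → (∀ x → f⁻ (f x) ≡ x) → (∀ y → f (f⁻ y) ≡ y) →
                ∀ y → sum (λ x → a x *L T (f x) y) ≃ a (f⁻ y)
  sum-reindex a f f⁻ f⁻∘f f∘f⁻ y =
    ≃-trans (sum-cong-≋ (λ x → ≃-trans (if-then-1-else-0 (does (y ≟F f x)) (a x))
              (if-cong (does-⇔ (mk⇔ (λ p → trans (cong f⁻ p) (f⁻∘f x)) (λ p → trans (sym (f∘f⁻ y)) (cong f p)))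
                                   (y ≟F f x) (f⁻ y ≟F x)))))
      (sum-δ (f⁻ y) a)

  linear-T : ∀ K u → linear K (T u) ≃H K u
  linear-T K u x = subst (_≃ K u x) (sym (linear-sum K (T u) x))
    (≃-trans (sum-cong-≋ (λ w → ≃-trans (*L-comm (T u w) (K w x))
                                  (≃-trans (if-then-1-else-0 (does (w ≟F u)) (K w x))
                                           (if-cong (does-⇔ (mk⇔ sym sym) (w ≟F u) (u ≟F w))))))
             (sum-δ u (λ w → K w x)))

  linear-T-id : ∀ h → linear T h ≃H h
  linear-T-id h x = subst (_≃ h x) (sym (linear-sum T h x)) (sum-reindex h (λ w → w) (λ w → w) (λ _ → refl) (λ _ → refl) x)

  linear-combT : ∀ K a u b u' → linear K ((a ⊙ T u) +H (b ⊙ T u')) ≃H ((a ⊙ K u) +H (b ⊙ K u'))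
  linear-combT K a u b u' =
    ≃H-trans (linear-comb K a (T u) b (T u')) (+H-cong (⊙-cong a (linear-T K u)) (⊙-cong b (linear-T K u')))

  linear-∘ : ∀ K K' h → linear K (linear K' h) ≃H linear (λ w → linear K (K' w)) h
  linear-∘ K K' h x = subst₂ _≃_ (sym (linear-sum K (linear K' h) x)) (sym (linear-sum (λ w → linear K (K' w)) h x))
    (≃-trans (sum-cong-≋ (λ v → ≃-trans (*L-congˡ (K v x) (≃-reflexive (linear-sum K' h v)))
                                 (≃-trans (*L-comm _ (K v x)) (*-distribˡ-sum (K v x) (λ w → h w *L K' w v)))))
    (≃-trans (∑-comm (λ v w → K v x *L (h w *L K' w v)))
    (sum-cong-≋ (λ w → ≃-trans (sum-cong-≋ (λ v → rotate (K v x) (h w) (K' w v)))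
                        (≃-trans (≃-sym (*-distribˡ-sum (h w) (λ v → K' w v *L K v x)))
                                 (*L-congʳ (h w) (≃-sym (≃-reflexive (linear-sum K (K' w) x)))))))))
    where
    rotate : ∀ a b c → (a *L (b *L c)) ≃ (b *L (c *L a))
    rotate = solve-∀ almostCommutativeRing

  linear-combine : ∀ K K' a b g → ((a ⊙ linear K g) +H (b ⊙ linear K' g)) ≃H linear (λ w → (a ⊙ K w) +H (b ⊙ K' w)) g
  linear-combine K K' a b g x =
    subst₂ _≃_ (sym (cong₂ (λ u v → (a *L u) +L (b *L v)) (linear-sum K g x) (linear-sum K' g x))) (sym (linear-sum _ g x))
      (≃-trans (+L-cong (*-distribˡ-sum a (λ w → g w *L K w x)) (*-distribˡ-sum b (λ w → g w *L K' w x)))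
      (≃-trans (≃-sym (∑-distrib-+ (λ w → a *L (g w *L K w x)) (λ w → b *L (g w *L K' w x)))) (sum-cong-≋ (λ w → regroup (g w) (K w x) (K' w x) a b))))
    where
    regroup : ∀ c k k' a b → ((a *L (c *L k)) +L (b *L (c *L k'))) ≃ (c *L ((a *L k) +L (b *L k')))
    regroup = solve-∀ almostCommutativeRing

  T·Ts-down : ∀ w j → ℓ (w · s j) < ℓ w → T·Ts w j ≡ (qL ⊙ T (w · s j)) +H ((qL -L 1L) ⊙ T w)
  T·Ts-down w j = if-<ᵇ-true

  T·Ts-up : ∀ w j → ℓ w < ℓ (w · s j) → T·Ts w j ≡ T (w · s j)
  T·Ts-up w j p = if-<ᵇ-false (NP.<⇒≤ p)

  Ts·T : Fin r → W → H
  Ts·T i w = if ℓ (s i · w) <ᵇ ℓ w then (qL ⊙ T (s i · w)) +H ((qL -L 1L) ⊙ T w) else T (s i · w)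

  Ts·T-down : ∀ i w → ℓ (s i · w) < ℓ w → Ts·T i w ≡ (qL ⊙ T (s i · w)) +H ((qL -L 1L) ⊙ T w)
  Ts·T-down i w = if-<ᵇ-true

  Ts·T-up : ∀ i w → ℓ w < ℓ (s i · w) → Ts·T i w ≡ T (s i · w)
  Ts·T-up i w p = if-<ᵇ-false (NP.<⇒≤ p)

  Ts· : Fin r → H → H
  Ts· i = linear (Ts·T i)

  ·Ts-cong : ∀ i {g g'} → g ≃H g' → (g ·Ts i) ≃H (g' ·Ts i)
  ·Ts-cong i = linear-cong (flip T·Ts i)

  Ts·-cong : ∀ i {g g'} → g ≃H g' → Ts· i g ≃H Ts· i g'
  Ts·-cong i = linear-cong (Ts·T i)

  T-·Ts : ∀ u i → (T u ·Ts i) ≃H T·Ts u i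
  T-·Ts u i = linear-T (flip T·Ts i) u

  suc≡⇒< : ∀ {a b} → suc a ≡ b → a < b
  suc≡⇒< refl = NP.≤-refl

  ≡suc⇒< : ∀ {a b} → b ≡ suc a → a < b
  ≡suc⇒< refl = NP.≤-refl

  T·Ts-·Ts : ∀ w i → (T·Ts w i ·Ts i) ≃H ((qL ⊙ T w) +H ((qL -L 1L) ⊙ T·Ts w i))
  T·Ts-·Ts w i with ℓ-·s w i
  ... | inj₂ down =
    ≃H-trans (≃H-reflexive (cong (_·Ts i) (T·Ts-down w i (suc≡⇒< down))))
    (≃H-trans (linear-combT (flip T·Ts i) qL (w · s i) (qL -L 1L) w)
      (+H-cong (⊙-cong qL (≃H-reflexive (trans (T·Ts-up (w · s i) i back-up) (cong T (·s·s w i))))) ≃H-refl))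
    where
    back-up : ℓ (w · s i) < ℓ ((w · s i) · s i)
    back-up = subst (λ z → ℓ (w · s i) < ℓ z) (sym (·s·s w i)) (suc≡⇒< down)
  ... | inj₁ up =
    ≃H-trans (≃H-reflexive (cong (_·Ts i) (T·Ts-up w i (≡suc⇒< up))))
    (≃H-trans (T-·Ts (w · s i) i)
    (≃H-trans (≃H-reflexive (T·Ts-down (w · s i) i back-down))
      (+H-cong (⊙-cong qL (≃H-reflexive (cong T (·s·s w i))))
               (⊙-cong (qL -L 1L) (≃H-reflexive (sym (T·Ts-up w i (≡suc⇒< up))))))))
    where
    back-down : ℓ ((w · s i) · s i) < ℓ (w · s i)
    back-down = subst (λ z → ℓ z < ℓ (w · s i)) (sym (·s·s w i)) (≡suc⇒< up)

  ·Ts-quadratic : ∀ i g → ((g ·Ts i) ·Ts i) ≃H ((qL ⊙ g) +H ((qL -L 1L) ⊙ (g ·Ts i)))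
  ·Ts-quadratic i g =
    ≃H-trans (linear-∘ (flip T·Ts i) (flip T·Ts i) g)
    (≃H-trans (linear-congˡ g (λ w → T·Ts-·Ts w i))
    (≃H-sym (≃H-trans (+H-cong (⊙-cong qL (≃H-sym (linear-T-id g))) ≃H-refl)
                      (linear-combine T (flip T·Ts i) qL (qL -L 1L) g))))

  -- Left and right multiplication commute on the basis; the two cases that would need a
  -- braid-type identity are exactly those where s·w·s≡w applies.
  module LeftRightCommute (i j : Fin r) (w : W) where

    sw wt swt : W
    sw  = s i · w
    wt  = w · s j
    swt = sw · s j

    s·wt : s i · wt ≡ swt
    s·wt = sym (assoc _ _ _)

    q-1 : Laurent
    q-1 = qL -L 1L

    Ts·T-wt-up : ℓ wt < ℓ swt → Ts·T i wt ≡ T swt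
    Ts·T-wt-up p = trans (Ts·T-up i wt (subst (ℓ wt <_) (cong ℓ (sym s·wt)) p)) (cong T s·wt)

    Ts·T-wt-down : ℓ swt < ℓ wt → Ts·T i wt ≡ (qL ⊙ T swt) +H (q-1 ⊙ T wt)
    Ts·T-wt-down p = trans (Ts·T-down i wt (subst (_< ℓ wt) (cong ℓ (sym s·wt)) p))
                           (cong (λ z → (qL ⊙ T z) +H (q-1 ⊙ T wt)) s·wt)

    left-up : ℓ w < ℓ sw → (Ts·T i w ·Ts j) ≃H T·Ts sw j
    left-up p = ≃H-trans (≃H-reflexive (cong (_·Ts j) (Ts·T-up i w p))) (T-·Ts sw j)

    left-down : ℓ sw < ℓ w → (Ts·T i w ·Ts j) ≃H ((qL ⊙ T·Ts sw j) +H (q-1 ⊙ T·Ts w j))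
    left-down p = ≃H-trans (≃H-reflexive (cong (_·Ts j) (Ts·T-down i w p))) (linear-combT (flip T·Ts j) qL sw q-1 w)

    right-up : ℓ w < ℓ wt → Ts· i (T·Ts w j) ≃H Ts·T i wt
    right-up p = ≃H-trans (≃H-reflexive (cong (Ts· i) (T·Ts-up w j p))) (linear-T (Ts·T i) wt)

    right-down : ℓ wt < ℓ w → Ts· i (T·Ts w j) ≃H ((qL ⊙ Ts·T i wt) +H (q-1 ⊙ Ts·T i w))
    right-down p = ≃H-trans (≃H-reflexive (cong (Ts· i) (T·Ts-down w j p))) (linear-combT (Ts·T i) qL wt q-1 w)

    ℓ-swt-≤ : ℓ swt ≤ suc (ℓ wt)
    ℓ-swt-≤ = subst (_≤ suc (ℓ wt)) (cong ℓ s·wt) (ℓ-s·-≤ wt i)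

    ℓ-wt-≤ : ℓ wt ≤ suc (ℓ swt)
    ℓ-wt-≤ = subst (λ z → ℓ wt ≤ suc (ℓ z)) s·wt (subst (λ z → ℓ z ≤ suc (ℓ (s i · wt))) (s·s· wt i) (ℓ-s·-≤ (s i · wt) i))

    three-steps : ∀ {a b c} → c ≡ suc (suc a) → suc b ≡ a → c ≤ suc b → ⊥
    three-steps refl refl p = NP.1+n≰n (NP.≤-trans (NP.n≤1+n _) (NP.≤-pred p))

    commute-sw-up : ℓ sw ≡ suc (ℓ w) → (Ts·T i w ·Ts j) ≃H Ts· i (T·Ts w j)
    commute-sw-up L with ℓ-·s w j | ℓ-·s sw j
    ... | inj₁ R | inj₁ X =
      ≃H-trans (left-up (≡suc⇒< L))
      (≃H-trans (≃H-reflexive (T·Ts-up sw j (≡suc⇒< X)))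
      (≃H-sym (≃H-trans (right-up (≡suc⇒< R))
                        (≃H-reflexive (Ts·T-wt-up (subst₂ _<_ (sym R) (sym (trans X (cong suc L))) (s≤s (NP.n<1+n _))))))))
    ... | inj₁ R | inj₂ X =
      ≃H-trans (left-up (≡suc⇒< L))
      (≃H-trans (≃H-reflexive (T·Ts-down sw j (suc≡⇒< X)))
      (≃H-sym (≃H-trans (right-up (≡suc⇒< R))
        (≃H-trans (≃H-reflexive (Ts·T-wt-down (subst₂ _<_ (sym (NP.suc-injective (trans X L))) (sym R) NP.≤-refl)))
                  (≃H-reflexive (cong (λ z → (qL ⊙ T swt) +H (q-1 ⊙ T z)) (sym sw≡wt)))))))
      where
      sw≡wt : sw ≡ wt
      sw≡wt = trans (sym (·s·s sw j)) (cong (_· s j) (s·w·s≡w w i j (≡suc⇒< L) (≡suc⇒< R) (suc≡⇒< X)))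
    ... | inj₂ R | inj₁ X = ⊥-elim (three-steps (trans X (cong suc L)) R ℓ-swt-≤)
    ... | inj₂ R | inj₂ X =
      ≃H-trans (left-up (≡suc⇒< L))
      (≃H-trans (≃H-reflexive (T·Ts-down sw j (suc≡⇒< X)))
      (≃H-sym (≃H-trans (right-down (suc≡⇒< R))
        (+H-cong (⊙-cong qL (≃H-reflexive (Ts·T-wt-up (NP.≤-reflexive (trans R (sym (NP.suc-injective (trans X L))))))))
                 (⊙-cong q-1 (≃H-reflexive (Ts·T-up i w (≡suc⇒< L))))))))

    commute-sw-down : suc (ℓ sw) ≡ ℓ w → (Ts·T i w ·Ts j) ≃H Ts· i (T·Ts w j)
    commute-sw-down L with ℓ-·s w j | ℓ-·s sw j
    ... | inj₁ R | inj₁ X =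
      ≃H-trans (left-down (suc≡⇒< L))
      (≃H-trans (+H-cong (⊙-cong qL (≃H-reflexive (T·Ts-up sw j (≡suc⇒< X)))) (⊙-cong q-1 (≃H-reflexive (T·Ts-up w j (≡suc⇒< R)))))
      (≃H-sym (≃H-trans (right-up (≡suc⇒< R)) (≃H-reflexive (Ts·T-wt-down (subst₂ _<_ (sym (trans X L)) (sym R) NP.≤-refl))))))
    ... | inj₁ R | inj₂ X = ⊥-elim (three-steps (trans R (cong suc (sym L))) X ℓ-wt-≤)
    ... | inj₂ R | inj₁ X =
      ≃H-trans (left-down (suc≡⇒< L))
      (≃H-trans (+H-cong (⊙-cong qL (≃H-reflexive (T·Ts-up sw j (≡suc⇒< X)))) (⊙-cong q-1 (≃H-reflexive (T·Ts-down w j (suc≡⇒< R)))))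
      (≃H-sym (≃H-trans (right-down (suc≡⇒< R))
        (+H-cong (⊙-cong qL (≃H-reflexive (Ts·T-wt-up (NP.≤-reflexive (trans R (sym (trans X L)))))))
                 (⊙-cong q-1 (≃H-reflexive (trans (Ts·T-down i w (suc≡⇒< L)) (cong (λ z → (qL ⊙ T z) +H (q-1 ⊙ T w)) sw≡wt))))))))
      where
      s·sw≡w : s i · sw ≡ w
      s·sw≡w = s·s· w i
      sw≡wt : sw ≡ wt
      sw≡wt = trans (sym (s·w·s≡w sw i j (subst (λ z → ℓ sw < ℓ z) (sym s·sw≡w) (suc≡⇒< L)) (≡suc⇒< X)
                                    (subst₂ (λ u v → ℓ (u · s j) < ℓ v) (sym s·sw≡w) (sym s·sw≡w) (suc≡⇒< R))))
                    (cong (_· s j) s·sw≡w)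
    ... | inj₂ R | inj₂ X =
      ≃H-trans (left-down (suc≡⇒< L))
      (≃H-trans (+H-cong (⊙-cong qL (≃H-reflexive (T·Ts-down sw j (suc≡⇒< X)))) (⊙-cong q-1 (≃H-reflexive (T·Ts-down w j (suc≡⇒< R)))))
      (≃H-trans (λ z → exchange-middle qL (T swt z) (T sw z) (T wt z) (T w z))
      (≃H-sym (≃H-trans (right-down (suc≡⇒< R))
        (+H-cong (⊙-cong qL (≃H-reflexive (Ts·T-wt-down (NP.<-≤-trans (suc≡⇒< X) (NP.≤-reflexive (NP.suc-injective (trans L (sym R))))))))
                 (⊙-cong q-1 (≃H-reflexive (Ts·T-down i w (suc≡⇒< L)))))))))
      where
      exchange-middle : ∀ q a b c d →
        ((q *L ((q *L a) +L ((q -L 1L) *L b))) +L ((q -L 1L) *L ((q *L c) +L ((q -L 1L) *L d))))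
        ≃ ((q *L ((q *L a) +L ((q -L 1L) *L c))) +L ((q -L 1L) *L ((q *L b) +L ((q -L 1L) *L d))))
      exchange-middle = solve-∀ almostCommutativeRing

    Ts·T-·Ts : (Ts·T i w ·Ts j) ≃H Ts· i (T·Ts w j)
    Ts·T-·Ts with ℓ-s· w i
    ... | inj₁ up   = commute-sw-up up
    ... | inj₂ down = commute-sw-down down

  Ts·-·Ts : ∀ i j g → (Ts· i g ·Ts j) ≃H Ts· i (g ·Ts j)
  Ts·-·Ts i j g =
    ≃H-trans (linear-∘ (flip T·Ts j) (Ts·T i) g)
    (≃H-trans (linear-congˡ g (λ w → LeftRightCommute.Ts·T-·Ts i j w))
              (≃H-sym (linear-∘ (Ts·T i) (flip T·Ts j) g)))

  _·Tword_ : H → List (Fin r) → H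
  h ·Tword a = foldl _·Ts_ h a

  Tword· : List (Fin r) → H → H
  Tword· b g = foldr Ts· g b

  ·Tword-cong : ∀ a {h h'} → h ≃H h' → (h ·Tword a) ≃H (h' ·Tword a)
  ·Tword-cong []      e = e
  ·Tword-cong (j ∷ a) e = ·Tword-cong a (·Ts-cong j e)

  Tword·-cong : ∀ b {h h'} → h ≃H h' → Tword· b h ≃H Tword· b h'
  Tword·-cong []      e = e
  Tword·-cong (i ∷ b) e = Ts·-cong i (Tword·-cong b e)

  ·Tword-∷ʳ : ∀ h a i → h ·Tword (a ++ (i ∷ [])) ≡ (h ·Tword a) ·Ts i
  ·Tword-∷ʳ h a i = LP.foldl-∷ʳ _·Ts_ h i a

  Ts·-·Tword : ∀ a i g → (Ts· i g ·Tword a) ≃H Ts· i (g ·Tword a)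
  Ts·-·Tword []      i g = ≃H-refl
  Ts·-·Tword (j ∷ a) i g = ≃H-trans (·Tword-cong a (Ts·-·Ts i j g)) (Ts·-·Tword a i (g ·Ts j))

  Tword·-·Tword : ∀ a b g → (Tword· b g ·Tword a) ≃H Tword· b (g ·Tword a)
  Tword·-·Tword a []      g = ≃H-refl
  Tword·-·Tword a (i ∷ b) g = ≃H-trans (Ts·-·Tword a i (Tword· b g)) (Ts·-cong i (Tword·-·Tword a b g))

  linear-·Tword : ∀ a K h → (linear K h ·Tword a) ≃H linear (λ w → K w ·Tword a) h
  linear-·Tword []      K h = ≃H-refl
  linear-·Tword (j ∷ a) K h = ≃H-trans (·Tword-cong a (linear-∘ (flip T·Ts j) K h)) (linear-·Tword a (λ w → K w ·Ts j) h)

  IsReduced : List (Fin r) → Set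
  IsReduced a = ℓ (prod a) ≡ length a

  reducedWord-isReduced : ∀ w → IsReduced (reducedWord w)
  reducedWord-isReduced w = trans (cong ℓ (prod-reducedWord w)) (sym (length-reducedWord w))

  IsReduced-tail : ∀ i a → IsReduced (i ∷ a) → IsReduced a
  IsReduced-tail i a p = NP.≤-antisym (ℓ-minimal (prod a) a refl)
                                      (NP.≤-pred (subst (_≤ suc (ℓ (prod a))) p (ℓ-s·-≤ (prod a) i)))

  IsReduced-prefix : ∀ u v → IsReduced (u ++ v) → IsReduced u
  IsReduced-prefix u v p = NP.≤-antisym (ℓ-minimal (prod u) u refl) (NP.+-cancelʳ-≤ (length v) (length u) (ℓ (prod u)) bound)
    where
    via-reducedWord : ℓ (prod (u ++ v)) ≤ ℓ (prod u) ℕ.+ length v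
    via-reducedWord =
      subst (ℓ (prod (u ++ v)) ≤_) (trans (LP.length-++ (reducedWord (prod u))) (cong (ℕ._+ length v) (length-reducedWord (prod u))))
        (ℓ-minimal (prod (u ++ v)) (reducedWord (prod u) ++ v)
          (trans (prod-++ (reducedWord (prod u)) v) (trans (cong (_· prod v) (prod-reducedWord (prod u))) (sym (prod-++ u v)))))
    bound : length u ℕ.+ length v ≤ ℓ (prod u) ℕ.+ length v
    bound = subst (_≤ ℓ (prod u) ℕ.+ length v) (trans p (LP.length-++ u)) via-reducedWord

  IsReduced-∷ʳ : ∀ w i → ℓ (w · s i) ≡ suc (ℓ w) → IsReduced (reducedWord w ++ (i ∷ []))
  IsReduced-∷ʳ w i p =
    trans (cong ℓ (trans (prod-∷ʳ (reducedWord w) i) (cong (_· s i) (prod-reducedWord w))))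
      (trans p (trans (cong suc (sym (length-reducedWord w)))
                      (trans (NP.+-comm 1 _) (sym (LP.length-++ (reducedWord w))))))

  Tword·-T-e : ∀ a → IsReduced a → Tword· a (T e) ≃H T (prod a)
  Tword·-T-e []      p = ≃H-refl
  Tword·-T-e (i ∷ a) p =
    ≃H-trans (Ts·-cong i (Tword·-T-e a reduced-a))
      (≃H-trans (linear-T (Ts·T i) (prod a)) (≃H-reflexive (Ts·T-up i (prod a) (subst₂ _<_ (sym reduced-a) (sym p) NP.≤-refl))))
    where
    reduced-a = IsReduced-tail i a p

  T-·Tword : ∀ a c → IsReduced (c ++ a) → (T (prod c) ·Tword a) ≃H T (prod (c ++ a))
  T-·Tword []      c p = ≃H-reflexive (cong (λ z → T (prod z)) (sym (LP.++-identityʳ c)))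
  T-·Tword (i ∷ a) c p =
    ≃H-trans (·Tword-cong a (≃H-trans (T-·Ts (prod c) i) (≃H-reflexive (trans (T·Ts-up (prod c) i up) (cong T (sym (prod-∷ʳ c i)))))))
      (≃H-trans (T-·Tword a (c ++ (i ∷ [])) p') (≃H-reflexive (cong (λ z → T (prod z)) (LP.++-assoc c (i ∷ []) a))))
    where
    p' : IsReduced ((c ++ (i ∷ [])) ++ a)
    p' = subst IsReduced (sym (LP.++-assoc c (i ∷ []) a)) p
    reduced-ci : IsReduced (c ++ (i ∷ []))
    reduced-ci = IsReduced-prefix (c ++ (i ∷ [])) a p'
    up : ℓ (prod c) < ℓ (prod c · s i)
    up = subst₂ _<_ (sym (IsReduced-prefix c (i ∷ []) reduced-ci))
           (sym (trans (cong ℓ (sym (prod-∷ʳ c i))) (trans reduced-ci (trans (LP.length-++ c) (NP.+-comm (length c) 1)))))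
           NP.≤-refl

  -- Writing h = Σ h(w) T_w with T_w = T_{s₁} ⋯ T_{s_k} T_e (a reduced word of w) and moving the right
  -- multiplications past the left ones shows that h · T_a only depends on prod a.
  ·Tword-expansion : ∀ a h → IsReduced a → (h ·Tword a) ≃H linear (λ w → Tword· (reducedWord w) (T (prod a))) h
  ·Tword-expansion a h p =
    ≃H-trans (·Tword-cong a (≃H-sym (≃H-trans (linear-congˡ h T-as-Tword·) (linear-T-id h))))
      (≃H-trans (linear-·Tword a (λ w → Tword· (reducedWord w) (T e)) h)
        (linear-congˡ h (λ w → ≃H-trans (Tword·-·Tword a (reducedWord w) (T e)) (Tword·-cong (reducedWord w) (T-·Tword a [] p)))))
    where
    T-as-Tword· : ∀ w → Tword· (reducedWord w) (T e) ≃H T w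
    T-as-Tword· w = ≃H-trans (Tword·-T-e (reducedWord w) (reducedWord-isReduced w)) (≃H-reflexive (cong T (prod-reducedWord w)))

  ·Tword-reduced : ∀ a b h → IsReduced a → IsReduced b → prod a ≡ prod b → (h ·Tword a) ≃H (h ·Tword b)
  ·Tword-reduced a b h ra rb eq =
    ≃H-trans (·Tword-expansion a h ra)
      (≃H-trans (≃H-reflexive (cong (λ z → linear (λ w → Tword· (reducedWord w) (T z)) h) eq))
                (≃H-sym (·Tword-expansion b h rb)))

  *H-T : ∀ h y → (h *H T y) ≃H (h ·Tword reducedWord y)
  *H-T h y = linear-T (λ y → h ·Tword reducedWord y) y

  *H-cong : ∀ h {g g'} → g ≃H g' → (h *H g) ≃H (h *H g')
  *H-cong h = linear-cong (λ y → h ·Tword reducedWord y)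

  *H-one : ∀ h → (h *H one) ≃H h
  *H-one h = ≃H-trans (*H-T h e) (≃H-reflexive (cong (h ·Tword_) reducedWord-e))

  *H-T·Ts : ∀ h i w → ((h *H T w) ·Ts i) ≃H (h *H T·Ts w i)
  *H-T·Ts h i w with ℓ-·s w i
  ... | inj₁ up =
    ≃H-trans (·Ts-cong i (*H-T h w))
    (≃H-sym (≃H-trans (≃H-reflexive (cong (h *H_) (T·Ts-up w i (≡suc⇒< up))))
            (≃H-trans (*H-T h (w · s i))
            (≃H-trans (·Tword-reduced (reducedWord (w · s i)) (reducedWord w ++ (i ∷ [])) h
                         (reducedWord-isReduced (w · s i)) (IsReduced-∷ʳ w i up)
                         (trans (prod-reducedWord (w · s i)) (sym (trans (prod-∷ʳ (reducedWord w) i) (cong (_· s i) (prod-reducedWord w))))))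
                      (≃H-reflexive (·Tword-∷ʳ h (reducedWord w) i))))))
  ... | inj₂ down =
    ≃H-trans (·Ts-cong i (≃H-trans (*H-T h w) h·Tw))
    (≃H-trans (·Ts-quadratic i (h ·Tword reducedWord (w · s i)))
    (≃H-trans (+H-cong (⊙-cong qL (≃H-sym (*H-T h (w · s i)))) (⊙-cong (qL -L 1L) (≃H-sym (≃H-trans (*H-T h w) h·Tw))))
    (≃H-sym (≃H-trans (≃H-reflexive (cong (h *H_) (T·Ts-down w i (suc≡⇒< down))))
                      (linear-comb (λ y → h ·Tword reducedWord y) qL (T (w · s i)) (qL -L 1L) (T w))))))
    where
    h·Tw : (h ·Tword reducedWord w) ≃H ((h ·Tword reducedWord (w · s i)) ·Ts i)
    h·Tw = ≃H-trans (·Tword-reduced (reducedWord w) (reducedWord (w · s i) ++ (i ∷ [])) h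
                       (reducedWord-isReduced w) (IsReduced-∷ʳ (w · s i) i (trans (cong ℓ (·s·s w i)) (sym down)))
                       (trans (prod-reducedWord w)
                              (sym (trans (trans (prod-∷ʳ (reducedWord (w · s i)) i) (cong (_· s i) (prod-reducedWord (w · s i)))) (·s·s w i)))))
                    (≃H-reflexive (·Tword-∷ʳ h (reducedWord (w · s i)) i))

  *H-·Ts : ∀ h i g → ((h *H g) ·Ts i) ≃H (h *H (g ·Ts i))
  *H-·Ts h i g =
    ≃H-trans (linear-∘ (flip T·Ts i) (λ y → h ·Tword reducedWord y) g)
    (≃H-trans (linear-congˡ g (λ w → ≃H-trans (·Ts-cong i (≃H-sym (*H-T h w))) (*H-T·Ts h i w)))
              (≃H-sym (linear-∘ (λ y → h ·Tword reducedWord y) (flip T·Ts i) g)))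

module InverseOperators (C : FiniteCoxeterSystem) where

  open import Data.Nat using (suc; _<_; _<ᵇ_)
  import Data.Nat.Properties as NP
  import Data.Integer as ℤ
  import Data.Integer.Tactic.RingSolver as ℤ-Solver
  open import Data.Fin using (Fin)
  open import Data.Fin.Properties using () renaming (_≟_ to _≟F_)
  open import Data.List using (List; []; _∷_; _++_; reverse; foldl)
  import Data.List.Properties as LP
  open import Data.Bool using (Bool; true; false; if_then_else_)
  open import Data.Sum using (inj₁; inj₂)
  open import Data.Empty using (⊥-elim)
  open import Function using (flip)
  open import Relation.Nullary using (does; yes; no)
  open import Relation.Nullary.Decidable using (dec-true; dec-false)
  import Data.Integer.Properties as ℤP
  open import Algebra.Structures using (IsGroup)
  open import Relation.Binary.PropositionalEquality
  open import Tactic.RingSolver using (solve-∀)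
  open import Algebra.Bundles using (CommutativeRing)

  open LaurentPolynomials hiding (_≋_)
  open Hecke C
  open CoxeterCombinatorics C
  open ExchangeCondition C using (ℓ-·s; ℓ-s·)
  open HeckeOperators C
  open IsGroup isGroup using (assoc; identityˡ; identityʳ; inverseˡ; inverseʳ)
  open import Algebra.Properties.Semiring.Sum (CommutativeRing.semiring commutativeRing)
    using (sum-cong-≋; ∑-distrib-+)

  _·Ts⁻¹_ : H → Fin r → H
  g ·Ts⁻¹ i = (q⁻¹L ⊙ (g ·Ts i)) +H ((q⁻¹L -L 1L) ⊙ g)

  q⁻¹*q : (q⁻¹L *L qL) ≃ 1L
  q⁻¹*q = qˆ-+ (ℤ.- (+ 1)) (+ 1)

  -- q⁻¹ (q A + (q - 1) B) + (q⁻¹ - 1) B = A; the solver treats q⁻¹ as an independent variable.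
  q⁻¹-cancels : ∀ A B → ((q⁻¹L *L ((qL *L A) +L ((qL -L 1L) *L B))) +L ((q⁻¹L -L 1L) *L B)) ≃ A
  q⁻¹-cancels A B = begin
    (q⁻¹L *L ((qL *L A) +L ((qL -L 1L) *L B))) +L ((q⁻¹L -L 1L) *L B)
      ≈⟨ expand qL q⁻¹L 1L A B ⟩
    ((q⁻¹L *L qL) *L A) +L ((((q⁻¹L *L qL) -L (q⁻¹L *L 1L)) +L (q⁻¹L -L 1L)) *L B)
      ≈⟨ +L-cong (≃-trans (*L-congˡ A q⁻¹*q) (*L-identityˡ A))
                 (*L-congˡ B (+L-cong (+L-cong q⁻¹*q (-L-cong (*L-identityʳ q⁻¹L))) (≃-refl {q⁻¹L -L 1L}))) ⟩
    A +L (((1L -L q⁻¹L) +L (q⁻¹L -L 1L)) *L B)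
      ≈⟨ telescope A 1L q⁻¹L B ⟩
    A ∎
    where
    open import Relation.Binary.Reasoning.Setoid (CommutativeRing.setoid commutativeRing)
    expand : ∀ q qi o A B → ((qi *L ((q *L A) +L ((q -L o) *L B))) +L ((qi -L o) *L B))
                           ≃ (((qi *L q) *L A) +L ((((qi *L q) -L (qi *L o)) +L (qi -L o)) *L B))
    expand = solve-∀ almostCommutativeRing
    telescope : ∀ A o qi B → (A +L (((o -L qi) +L (qi -L o)) *L B)) ≃ A
    telescope = solve-∀ almostCommutativeRing

  ·Ts⁻¹-cong : ∀ i {g g'} → g ≃H g' → (g ·Ts⁻¹ i) ≃H (g' ·Ts⁻¹ i)
  ·Ts⁻¹-cong i e = +H-cong (⊙-cong q⁻¹L (·Ts-cong i e)) (⊙-cong (q⁻¹L -L 1L) e)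

  ·Ts-·Ts⁻¹ : ∀ i g → ((g ·Ts i) ·Ts⁻¹ i) ≃H g
  ·Ts-·Ts⁻¹ i g z = ≃-trans (+L-cong (*L-congʳ q⁻¹L (·Ts-quadratic i g z)) ≃-refl) (q⁻¹-cancels (g z) ((g ·Ts i) z))

  ·Ts⁻¹-·Ts : ∀ i g → ((g ·Ts⁻¹ i) ·Ts i) ≃H g
  ·Ts⁻¹-·Ts i g = ≃H-trans (linear-comb (flip T·Ts i) q⁻¹L (g ·Ts i) (q⁻¹L -L 1L) g) (·Ts-·Ts⁻¹ i g)

  linear-·Ts⁻¹ : ∀ i K h → (linear K h ·Ts⁻¹ i) ≃H linear (λ w → K w ·Ts⁻¹ i) h
  linear-·Ts⁻¹ i K h =
    ≃H-trans (+H-cong (⊙-cong q⁻¹L (linear-∘ (flip T·Ts i) K h)) ≃H-refl)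
             (linear-combine (λ w → K w ·Ts i) K q⁻¹L (q⁻¹L -L 1L) h)

  *H-·Ts⁻¹ : ∀ h i g → (h *H (g ·Ts⁻¹ i)) ≃H ((h *H g) ·Ts⁻¹ i)
  *H-·Ts⁻¹ h i g =
    ≃H-trans (linear-comb (λ y → h ·Tword reducedWord y) q⁻¹L (g ·Ts i) (q⁻¹L -L 1L) g)
             (+H-cong (⊙-cong q⁻¹L (≃H-sym (*H-·Ts h i g))) ≃H-refl)

  _·DTword_ : H → List (Fin r) → H
  g ·DTword a = foldl _·Ts⁻¹_ g a

  ·DTword-cong : ∀ a {h h'} → h ≃H h' → (h ·DTword a) ≃H (h' ·DTword a)
  ·DTword-cong []      e = e
  ·DTword-cong (j ∷ a) e = ·DTword-cong a (·Ts⁻¹-cong j e)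

  ·DTword-∷ʳ : ∀ h a i → h ·DTword (a ++ (i ∷ [])) ≡ (h ·DTword a) ·Ts⁻¹ i
  ·DTword-∷ʳ h a i = LP.foldl-∷ʳ _·Ts⁻¹_ h i a

  ·DTword-reverse-∷ : ∀ h i a → h ·DTword reverse (i ∷ a) ≡ (h ·DTword reverse a) ·Ts⁻¹ i
  ·DTword-reverse-∷ h i a = trans (cong (h ·DTword_) (LP.unfold-reverse i a)) (·DTword-∷ʳ h (reverse a) i)

  ·Tword-·DTword-reverse : ∀ a g → ((g ·Tword a) ·DTword reverse a) ≃H g
  ·Tword-·DTword-reverse []      g = ≃H-refl
  ·Tword-·DTword-reverse (i ∷ a) g =
    ≃H-trans (≃H-reflexive (·DTword-reverse-∷ ((g ·Ts i) ·Tword a) i a))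
      (≃H-trans (·Ts⁻¹-cong i (·Tword-·DTword-reverse a (g ·Ts i))) (·Ts-·Ts⁻¹ i g))

  ·DTword-reverse-·Tword : ∀ a g → ((g ·DTword reverse a) ·Tword a) ≃H g
  ·DTword-reverse-·Tword []      g = ≃H-refl
  ·DTword-reverse-·Tword (i ∷ a) g =
    ≃H-trans (·Tword-cong a (·Ts-cong i (≃H-reflexive (·DTword-reverse-∷ g i a))))
      (≃H-trans (·Tword-cong a (·Ts⁻¹-·Ts i _)) (·DTword-reverse-·Tword a g))

  *H-·DTword : ∀ h a g → (h *H (g ·DTword a)) ≃H ((h *H g) ·DTword a)
  *H-·DTword h []      g = ≃H-refl
  *H-·DTword h (i ∷ a) g = ≃H-trans (*H-·DTword h a (g ·Ts⁻¹ i)) (·DTword-cong a (*H-·Ts⁻¹ h i g))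

  ·Ts-coeff-shorter ·Ts-coeff-same : Fin r → W → Laurent
  ·Ts-coeff-shorter i x = if ℓ (x · s i) <ᵇ ℓ x then qL else 1L
  ·Ts-coeff-same    i x = if ℓ (x · s i) <ᵇ ℓ x then qL -L 1L else 0L

  T·Ts-decomposition : ∀ x i → T·Ts x i ≃H ((·Ts-coeff-shorter i x ⊙ T (x · s i)) +H (·Ts-coeff-same i x ⊙ T x))
  T·Ts-decomposition x i with ℓ (x · s i) <ᵇ ℓ x
  ... | true  = ≃H-refl
  ... | false = λ z → pad (T (x · s i) z) (T x z)
    where
    pad : ∀ a b → a ≃ ((1L *L a) +L (0L *L b))
    pad = solve-∀ almostCommutativeRing

  ·Ts-at : ∀ i g y → (g ·Ts i) y ≃ ((·Ts-coeff-shorter i (y · s i) *L g (y · s i)) +L (·Ts-coeff-same i y *L g y))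
  ·Ts-at i g y =
    ≃-trans (linear-congˡ g (λ x → T·Ts-decomposition x i) y)
    (subst (_≃ ((·Ts-coeff-shorter i (y · s i) *L g (y · s i)) +L (·Ts-coeff-same i y *L g y)))
           (sym (linear-sum (λ x → (·Ts-coeff-shorter i x ⊙ T (x · s i)) +H (·Ts-coeff-same i x ⊙ T x)) g y))
    (≃-trans (sum-cong-≋ (λ x → distribute (g x) (·Ts-coeff-shorter i x) (T (x · s i) y) (·Ts-coeff-same i x) (T x y)))
    (≃-trans (∑-distrib-+ (λ x → (g x *L ·Ts-coeff-shorter i x) *L T (x · s i) y) (λ x → (g x *L ·Ts-coeff-same i x) *L T x y))
    (+L-cong (≃-trans (sum-reindex (λ x → g x *L ·Ts-coeff-shorter i x) (_· s i) (_· s i) (λ x → ·s·s x i) (λ x → ·s·s x i) y)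
                      (*L-comm (g (y · s i)) _))
             (≃-trans (sum-reindex (λ x → g x *L ·Ts-coeff-same i x) (λ x → x) (λ x → x) (λ _ → refl) (λ _ → refl) y)
                      (*L-comm (g y) _))))))
    where
    distribute : ∀ g a t b t' → (g *L ((a *L t) +L (b *L t'))) ≃ (((g *L a) *L t) +L ((g *L b) *L t'))
    distribute = solve-∀ almostCommutativeRing

  ·Ts⁻¹-at-ascent : ∀ i g y → ℓ y < ℓ (y · s i) → (g ·Ts⁻¹ i) y ≃ (g (y · s i) +L ((q⁻¹L -L 1L) *L g y))
  ·Ts⁻¹-at-ascent i g y up = begin
    (q⁻¹L *L (g ·Ts i) y) +L ((q⁻¹L -L 1L) *L g y)
      ≈⟨ +L-cong (*L-congʳ q⁻¹L (≃-trans (·Ts-at i g y) coefficients)) ≃-refl ⟩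
    (q⁻¹L *L ((qL *L g (y · s i)) +L (0L *L g y))) +L ((q⁻¹L -L 1L) *L g y)
      ≈⟨ simplify q⁻¹L qL (g (y · s i)) (q⁻¹L -L 1L) (g y) ⟩
    ((q⁻¹L *L qL) *L g (y · s i)) +L ((q⁻¹L -L 1L) *L g y)
      ≈⟨ +L-cong (≃-trans (*L-congˡ (g (y · s i)) q⁻¹*q) (*L-identityˡ (g (y · s i)))) (≃-refl {(q⁻¹L -L 1L) *L g y}) ⟩
    g (y · s i) +L ((q⁻¹L -L 1L) *L g y) ∎
    where
    open import Relation.Binary.Reasoning.Setoid (CommutativeRing.setoid commutativeRing)
    coefficients : ((·Ts-coeff-shorter i (y · s i) *L g (y · s i)) +L (·Ts-coeff-same i y *L g y))
                   ≃ ((qL *L g (y · s i)) +L (0L *L g y))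
    coefficients = ≃-reflexive (cong₂ (λ a b → (a *L g (y · s i)) +L (b *L g y))
      (if-<ᵇ-true (subst (λ z → ℓ z < ℓ (y · s i)) (sym (·s·s y i)) up)) (if-<ᵇ-false (NP.<⇒≤ up)))
    simplify : ∀ qi q a c b → ((qi *L ((q *L a) +L (0L *L b))) +L (c *L b)) ≃ (((qi *L q) *L a) +L (c *L b))
    simplify = solve-∀ almostCommutativeRing

  ·Ts⁻¹-at-descent : ∀ i g y → ℓ (y · s i) < ℓ y → (g ·Ts⁻¹ i) y ≃ (q⁻¹L *L g (y · s i))
  ·Ts⁻¹-at-descent i g y down = begin
    (q⁻¹L *L (g ·Ts i) y) +L ((q⁻¹L -L 1L) *L g y)
      ≈⟨ +L-cong (*L-congʳ q⁻¹L (≃-trans (·Ts-at i g y) coefficients)) ≃-refl ⟩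
    (q⁻¹L *L ((1L *L g (y · s i)) +L ((qL -L 1L) *L g y))) +L ((q⁻¹L -L 1L) *L g y)
      ≈⟨ expand q⁻¹L qL 1L (g (y · s i)) (g y) ⟩
    (q⁻¹L *L (1L *L g (y · s i))) +L ((((q⁻¹L *L qL) -L (q⁻¹L *L 1L)) +L (q⁻¹L -L 1L)) *L g y)
      ≈⟨ +L-cong (*L-congʳ q⁻¹L (*L-identityˡ (g (y · s i))))
                 (*L-congˡ (g y) (+L-cong (+L-cong q⁻¹*q (-L-cong (*L-identityʳ q⁻¹L))) (≃-refl {q⁻¹L -L 1L}))) ⟩
    (q⁻¹L *L g (y · s i)) +L (((1L -L q⁻¹L) +L (q⁻¹L -L 1L)) *L g y)
      ≈⟨ telescope (q⁻¹L *L g (y · s i)) 1L q⁻¹L (g y) ⟩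
    q⁻¹L *L g (y · s i) ∎
    where
    open import Relation.Binary.Reasoning.Setoid (CommutativeRing.setoid commutativeRing)
    coefficients : ((·Ts-coeff-shorter i (y · s i) *L g (y · s i)) +L (·Ts-coeff-same i y *L g y))
                   ≃ ((1L *L g (y · s i)) +L ((qL -L 1L) *L g y))
    coefficients = ≃-reflexive (cong₂ (λ a b → (a *L g (y · s i)) +L (b *L g y))
      (if-<ᵇ-false (NP.<⇒≤ (subst (λ z → ℓ (y · s i) < ℓ z) (sym (·s·s y i)) down))) (if-<ᵇ-true down))
    expand : ∀ qi q o a b → ((qi *L ((o *L a) +L ((q -L o) *L b))) +L ((qi -L o) *L b))
                          ≃ ((qi *L (o *L a)) +L ((((qi *L q) -L (qi *L o)) +L (qi -L o)) *L b))
    expand = solve-∀ almostCommutativeRing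
    telescope : ∀ A o qi B → (A +L (((o -L qi) +L (qi -L o)) *L B)) ≃ A
    telescope = solve-∀ almostCommutativeRing

  barH : H → H
  barH h w = barL (h w)

  barH-linear : ∀ K g → barH (linear K g) ≃H linear (λ w → barH (K w)) (barH g)
  barH-linear K g x = subst₂ _≃_ (sym (cong barL (linear-sum K g x))) (sym (linear-sum (λ w → barH (K w)) (barH g) x))
    (≃-trans (barL-sum (λ w → g w *L K w x)) (sum-cong-≋ (λ w → barL-*L (g w) (K w x))))

  barH-T : ∀ u → barH (T u) ≃H T u
  barH-T u x = barL-δ (does (x ≟F u))
    where
    barL-δ : ∀ (b : Bool) → barL (if b then 1L else 0L) ≃ (if b then 1L else 0L)
    barL-δ true  = barL-qˆ (+ 0)
    barL-δ false = barL-0L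

  barH-comb : ∀ a g b g' → barH ((a ⊙ g) +H (b ⊙ g')) ≃H ((barL a ⊙ barH g) +H (barL b ⊙ barH g'))
  barH-comb a g b g' x = ≃-trans (barL-+L (a *L g x) (b *L g' x)) (+L-cong (barL-*L a (g x)) (barL-*L b (g' x)))

  barL-q-1 : barL (qL -L 1L) ≃ (q⁻¹L -L 1L)
  barL-q-1 = ≃-trans (barL-+L qL (-L 1L)) (+L-cong (barL-qˆ (+ 1)) (≃-trans (barL--L 1L) (-L-cong (barL-qˆ (+ 0)))))

  module WithLeftInverses (inv : W → H) (inv-*H-T : ∀ w → (inv w *H T w) ≈H one) where

    inv-via-reducedWord : ∀ w → inv w ≃H (one ·DTword reverse (reducedWord w))
    inv-via-reducedWord w =
      ≃H-trans (≃H-sym (·Tword-·DTword-reverse (reducedWord w) (inv w)))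
        (·DTword-cong (reverse (reducedWord w)) (≃H-trans (≃H-sym (*H-T (inv w) w)) (λ x → mk≃ (inv-*H-T w x))))

    inv-via-reduced : ∀ a w → IsReduced a → prod a ≡ w → (one ·DTword reverse a) ≃H inv w
    inv-via-reduced a w reduced-a eq =
      ≃H-trans (·DTword-cong (reverse a) (≃H-sym one≃)) (·Tword-·DTword-reverse a (inv w))
      where
      one≃ : (inv w ·Tword a) ≃H one
      one≃ = ≃H-trans (·Tword-cong a (inv-via-reducedWord w))
               (≃H-trans (·Tword-reduced a (reducedWord w) _ reduced-a (reducedWord-isReduced w) (trans eq (sym (prod-reducedWord w))))
                         (·DTword-reverse-·Tword (reducedWord w) one))

    inv-s·-ascent : ∀ y i → ℓ y < ℓ (s i · y) → inv (s i · y) ≃H (inv y ·Ts⁻¹ i)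
    inv-s·-ascent y i lt =
      ≃H-trans (≃H-sym (inv-via-reduced (i ∷ reducedWord y) (s i · y) reduced (cong (s i ·_) (prod-reducedWord y))))
        (≃H-trans (≃H-reflexive (·DTword-reverse-∷ one i (reducedWord y)))
                  (·Ts⁻¹-cong i (≃H-sym (inv-via-reducedWord y))))
      where
      longer : ℓ (s i · y) ≡ suc (ℓ y)
      longer with ℓ-s· y i
      ... | inj₁ p = p
      ... | inj₂ p = ⊥-elim (NP.<-asym lt (subst (ℓ (s i · y) <_) p NP.≤-refl))
      reduced : IsReduced (i ∷ reducedWord y)
      reduced = trans (cong (λ z → ℓ (s i · z)) (prod-reducedWord y)) (trans longer (cong suc (sym (length-reducedWord y))))

    inv-·Ts-descent : ∀ y i → ℓ (s i · y) < ℓ y → (inv y ·Ts i) ≃H inv (s i · y)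
    inv-·Ts-descent y i lt =
      ≃H-trans (·Ts-cong i (≃H-trans (≃H-reflexive (cong inv (sym (s·s· y i)))) (inv-s·-ascent (s i · y) i ascent)))
               (·Ts⁻¹-·Ts i (inv (s i · y)))
      where
      ascent : ℓ (s i · y) < ℓ (s i · (s i · y))
      ascent = subst (λ z → ℓ (s i · y) < ℓ z) (sym (s·s· y i)) lt

    D-linear : ∀ K g → D inv (linear K g) ≃H linear (λ w → D inv (K w)) (barH g)
    D-linear K g = ≃H-trans (linear-cong (λ w → inv (w ⁻¹)) (barH-linear K g)) (linear-∘ (λ w → inv (w ⁻¹)) (λ w → barH (K w)) (barH g))

    D-T : ∀ u → D inv (T u) ≃H inv (u ⁻¹)
    D-T u = ≃H-trans (linear-cong (λ w → inv (w ⁻¹)) (barH-T u)) (linear-T (λ w → inv (w ⁻¹)) u)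

    D-T·Ts : ∀ i w → D inv (T·Ts w i) ≃H (inv (w ⁻¹) ·Ts⁻¹ i)
    D-T·Ts i w with ℓ-·s w i
    ... | inj₁ up =
      ≃H-trans (≃H-reflexive (cong (D inv) (T·Ts-up w i (≡suc⇒< up))))
        (≃H-trans (D-T (w · s i)) (≃H-trans (≃H-reflexive (cong inv ([x·s]⁻¹ w i))) (inv-s·-ascent (w ⁻¹) i ascent)))
      where
      ascent : ℓ (w ⁻¹) < ℓ (s i · (w ⁻¹))
      ascent = subst₂ _<_ (sym (ℓ-⁻¹ w)) (trans (sym up) (trans (sym (ℓ-⁻¹ (w · s i))) (cong ℓ ([x·s]⁻¹ w i)))) NP.≤-refl
    ... | inj₂ down =
      ≃H-trans (≃H-reflexive (cong (D inv) (T·Ts-down w i (suc≡⇒< down))))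
        (≃H-trans (linear-cong (λ w → inv (w ⁻¹)) (≃H-trans (barH-comb qL (T (w · s i)) (qL -L 1L) (T w))
                                                           (+H-cong (⊙-cong (barL qL) (barH-T (w · s i))) (⊙-cong (barL (qL -L 1L)) (barH-T w)))))
        (≃H-trans (linear-combT (λ w → inv (w ⁻¹)) (barL qL) (w · s i) (barL (qL -L 1L)) w)
        (+H-cong (≃H-trans (⊙-congˡ (inv ((w · s i) ⁻¹)) (barL-qˆ (+ 1)))
                           (⊙-cong q⁻¹L (≃H-sym (≃H-trans (inv-·Ts-descent (w ⁻¹) i descent) (≃H-reflexive (cong inv (sym ([x·s]⁻¹ w i))))))))
                 (⊙-congˡ (inv (w ⁻¹)) barL-q-1))))
      where
      descent : ℓ (s i · (w ⁻¹)) < ℓ (w ⁻¹)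
      descent = subst₂ _<_ (trans (sym (ℓ-⁻¹ (w · s i))) (cong ℓ ([x·s]⁻¹ w i))) (sym (ℓ-⁻¹ w)) (suc≡⇒< down)

    D-·Ts : ∀ i g → D inv (g ·Ts i) ≃H (D inv g ·Ts⁻¹ i)
    D-·Ts i g =
      ≃H-trans (D-linear (flip T·Ts i) g)
        (≃H-trans (linear-congˡ (barH g) (D-T·Ts i)) (≃H-sym (linear-·Ts⁻¹ i (λ w → inv (w ⁻¹)) (barH g))))

    D-·Tword : ∀ a g → D inv (g ·Tword a) ≃H (D inv g ·DTword a)
    D-·Tword []      g = ≃H-refl
    D-·Tword (i ∷ a) g = ≃H-trans (D-·Tword a (g ·Ts i)) (·DTword-cong a (D-·Ts i g))

    D-one : D inv one ≃H one
    D-one = ≃H-trans (D-T e) (≃H-trans (≃H-reflexive (cong inv ε⁻¹≈ε))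
              (≃H-trans (inv-via-reducedWord e) (≃H-reflexive (cong (λ z → one ·DTword reverse z) reducedWord-e))))

    T*D[Tword] : ∀ v word → (T v *H D inv (Tword word)) ≃H (T v ·DTword word)
    T*D[Tword] v word =
      ≃H-trans (*H-cong (T v) (≃H-trans (D-·Tword word one) (·DTword-cong word D-one)))
        (≃H-trans (*H-·DTword (T v) word one) (·DTword-cong word (*H-one (T v))))

  module Expansion (v : W) where

    coefficient : List (Fin r) → W → Laurent
    coefficient rw y = qˆ (+ ℓ v) *L (Rrev v q⁻¹L ((v ⁻¹) · y) rw *L qˆ (- (+ ℓ y)))

    v·[v⁻¹·y] : ∀ y → v · ((v ⁻¹) · y) ≡ y
    v·[v⁻¹·y] y = trans (sym (assoc _ _ _)) (trans (cong (_· y) (inverseʳ v)) (identityˡ y))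

    v⁻¹·[v·u] : ∀ u → (v ⁻¹) · (v · u) ≡ u
    v⁻¹·[v·u] u = trans (sym (assoc _ _ _)) (trans (cong (_· u) (inverseˡ v)) (identityˡ u))

    qˆ-ℓ-suc : ∀ a b → ℓ a ≡ suc (ℓ b) → qˆ (- (+ ℓ a)) ≃ (q⁻¹L *L qˆ (- (+ ℓ b)))
    qˆ-ℓ-suc a b p = ≃-sym (≃-trans (qˆ-+ (- (+ 1)) (- (+ ℓ b))) (qˆ-cong (trans (negate (+ ℓ b)) (cong (λ k → - (+ k)) (sym p)))))
      where
      negate : ∀ t → - (+ 1) ℤ.+ - t ≡ - (+ 1 ℤ.+ t)
      negate = ℤ-Solver.solve-∀

    T-coefficient : T v ≃H coefficient []
    T-coefficient y with y ≟F v
    ... | yes refl = ≃-sym (≃-trans (*L-congʳ (qˆ (+ ℓ v)) (≃-trans (*L-congˡ (qˆ (- (+ ℓ v))) (≃-reflexive R-e)) (*L-identityˡ (qˆ (- (+ ℓ v))))))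
                             (≃-trans (qˆ-+ (+ ℓ v) (- (+ ℓ v))) (qˆ-cong (ℤP.+-inverseʳ (+ ℓ v)))))
      where
      R-e : Rrev v q⁻¹L ((v ⁻¹) · v) [] ≡ 1L
      R-e = cong (λ b → if b then 1L else 0L) (dec-true (((v ⁻¹) · v) ≟F e) (inverseˡ v))
    ... | no y≢v = ≃-sym (≃-trans (*L-congʳ (qˆ (+ ℓ v)) (≃-trans (*L-congˡ (qˆ (- (+ ℓ y))) (≃-reflexive R-0)) (*L-zeroˡ (qˆ (- (+ ℓ y))))))
                                  (≃-trans (*L-comm (qˆ (+ ℓ v)) 0L) (*L-zeroˡ (qˆ (+ ℓ v)))))
      where
      R-0 : Rrev v q⁻¹L ((v ⁻¹) · y) [] ≡ 0L
      R-0 = cong (λ b → if b then 1L else 0L)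
              (dec-false (((v ⁻¹) · y) ≟F e) (λ p → y≢v (trans (sym (v·[v⁻¹·y] y)) (trans (cong (v ·_) p) (identityʳ v)))))

    coefficient-∷-ascent : ∀ g i rw y → g ≃H coefficient rw → ℓ (y · s i) ≡ suc (ℓ y) →
                           (g ·Ts⁻¹ i) y ≃ coefficient (i ∷ rw) y
    coefficient-∷-ascent g i rw y g≃ up = begin
      (g ·Ts⁻¹ i) y
        ≈⟨ ·Ts⁻¹-at-ascent i g y (≡suc⇒< up) ⟩
      g (y · s i) +L ((q⁻¹L -L 1L) *L g y)
        ≈⟨ +L-cong (≃-trans (g≃ (y · s i)) (*L-congʳ Q (*L-cong (≃-reflexive (cong (λ z → Rrev v q⁻¹L z rw) (sym (assoc _ _ _))))
                                                                  (qˆ-ℓ-suc (y · s i) y up))))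
                   (*L-congʳ (q⁻¹L -L 1L) (g≃ y)) ⟩
      (Q *L (R₁ *L (q⁻¹L *L M))) +L ((q⁻¹L -L 1L) *L (Q *L (R₀ *L M)))
        ≈⟨ collect Q R₁ R₀ M q⁻¹L ⟩
      Q *L (((q⁻¹L *L R₁) +L ((q⁻¹L -L 1L) *L R₀)) *L M)
        ≈⟨ *L-congʳ Q (*L-congˡ M (≃-reflexive (sym (if-<ᵇ-false (NP.<⇒≤ v-ascent))))) ⟩
      coefficient (i ∷ rw) y ∎
      where
      open import Relation.Binary.Reasoning.Setoid (CommutativeRing.setoid commutativeRing)
      Q = qˆ (+ ℓ v)
      M = qˆ (- (+ ℓ y))
      u = (v ⁻¹) · y
      R₁ = Rrev v q⁻¹L (u · s i) rw
      R₀ = Rrev v q⁻¹L u rw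
      v-ascent : ℓ (v · u) < ℓ (v · (u · s i))
      v-ascent = subst₂ (λ a b → ℓ a < ℓ b) (sym (v·[v⁻¹·y] y)) (trans (sym (cong (_· s i) (v·[v⁻¹·y] y))) (assoc _ _ _)) (≡suc⇒< up)
      collect : ∀ Q R₁ R₀ M x → ((Q *L (R₁ *L (x *L M))) +L ((x -L 1L) *L (Q *L (R₀ *L M))))
                              ≃ (Q *L (((x *L R₁) +L ((x -L 1L) *L R₀)) *L M))
      collect = solve-∀ almostCommutativeRing

    coefficient-∷-descent : ∀ g i rw y → g ≃H coefficient rw → suc (ℓ (y · s i)) ≡ ℓ y →
                            (g ·Ts⁻¹ i) y ≃ coefficient (i ∷ rw) y
    coefficient-∷-descent g i rw y g≃ down = begin
      (g ·Ts⁻¹ i) y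
        ≈⟨ ·Ts⁻¹-at-descent i g y (suc≡⇒< down) ⟩
      q⁻¹L *L g (y · s i)
        ≈⟨ *L-congʳ q⁻¹L (≃-trans (g≃ (y · s i)) (*L-congʳ Q (*L-congˡ (qˆ (- (+ ℓ (y · s i))))
                                     (≃-reflexive (cong (λ z → Rrev v q⁻¹L z rw) (sym (assoc _ _ _))))))) ⟩
      q⁻¹L *L (Q *L (R₁ *L qˆ (- (+ ℓ (y · s i)))))
        ≈⟨ rotate q⁻¹L Q R₁ (qˆ (- (+ ℓ (y · s i)))) ⟩
      Q *L (R₁ *L (q⁻¹L *L qˆ (- (+ ℓ (y · s i)))))
        ≈⟨ *L-congʳ Q (*L-cong (≃-reflexive (sym (if-<ᵇ-true v-descent))) (≃-sym (qˆ-ℓ-suc y (y · s i) (sym down)))) ⟩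
      coefficient (i ∷ rw) y ∎
      where
      open import Relation.Binary.Reasoning.Setoid (CommutativeRing.setoid commutativeRing)
      Q = qˆ (+ ℓ v)
      u = (v ⁻¹) · y
      R₁ = Rrev v q⁻¹L (u · s i) rw
      v-descent : ℓ (v · (u · s i)) < ℓ (v · u)
      v-descent = subst₂ (λ a b → ℓ a < ℓ b) (trans (sym (cong (_· s i) (v·[v⁻¹·y] y))) (assoc _ _ _)) (sym (v·[v⁻¹·y] y)) (suc≡⇒< down)
      rotate : ∀ x Q R M → (x *L (Q *L (R *L M))) ≃ (Q *L (R *L (x *L M)))
      rotate = solve-∀ almostCommutativeRing

    T-·DTword-reverse : ∀ rw → (T v ·DTword reverse rw) ≃H coefficient rw
    T-·DTword-reverse []       = T-coefficient
    T-·DTword-reverse (i ∷ rw) y with ℓ-·s y i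
    ... | inj₁ up   = ≃-trans (≃-reflexive (cong (λ h → h y) (·DTword-reverse-∷ (T v) i rw)))
                              (coefficient-∷-ascent _ i rw y (T-·DTword-reverse rw) up)
    ... | inj₂ down = ≃-trans (≃-reflexive (cong (λ h → h y) (·DTword-reverse-∷ (T v) i rw)))
                              (coefficient-∷-descent _ i rw y (T-·DTword-reverse rw) down)

    T-·DTword : ∀ word → (T v ·DTword word)
      ≃H (qˆ (+ ℓ v) ⊙ sumW (λ u → (R v q⁻¹L u word *L qˆ (- (+ ℓ (v · u)))) ⊙ T (v · u)))
    T-·DTword word y =
      ≃-trans (≃-reflexive (cong (λ z → (T v ·DTword z) y) (sym (LP.reverse-involutive word))))
      (≃-trans (T-·DTword-reverse (reverse word) y)
      (*L-congʳ (qˆ (+ ℓ v)) (≃-sym (subst (_≃ (R v q⁻¹L ((v ⁻¹) · y) word *L qˆ (- (+ ℓ y)))) (sym (sum-sumW F y))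
        (≃-trans (sum-reindex c (v ·_) ((v ⁻¹) ·_) v⁻¹·[v·u] v·[v⁻¹·y] y)
                 (*L-congʳ (R v q⁻¹L ((v ⁻¹) · y) word) (qˆ-cong (cong (λ z → - (+ ℓ z)) (v·[v⁻¹·y] y)))))))))
      where
      c : W → Laurent
      c u = R v q⁻¹L u word *L qˆ (- (+ ℓ (v · u)))
      F : W → H
      F u = c u ⊙ T (v · u)

proposition5p1 : (C : FiniteCoxeterSystem) →
    let open Hecke C in
    (inv : W → H) → (∀ w → (T w *H inv w) ≈H one) → (∀ w → (inv w *H T w) ≈H one) →
    (word : List (Fin r)) (v : W) →
    (T v *H D inv (Tword word))
    ≈H (qˆ (+ ℓ v) ⊙ sumW (λ u → (R v q⁻¹L u word *L qˆ (- (+ ℓ (v · u)))) ⊙ T (v · u)))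
proposition5p1 C inv _ inv-*H-T word v w =
  LaurentPolynomials.get (≃H-trans (T*D[Tword] v word) (T-·DTword word) w)
  where
  open HeckeOperators C using (≃H-trans)
  open InverseOperators C using (module WithLeftInverses; module Expansion)
  open WithLeftInverses inv inv-*H-T using (T*D[Tword])
  open Expansion v using (T-·DTword)
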